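{- Let $\mu$ be a given partition. For every integer $n\ge|\mu|$, $$\sum_{|\lambda|=n,\ \lambda\supseteq\mu}\frac{H_\mu f_{\lambda/\mu}}{H_\lambda}\bigl(S(\lambda,1)-S(\mu,1)\bigr)=\frac32(n-|\mu|)(n+|\mu|-1).$$
   Context: Partitions are identified with Young diagrams; $h_\square$ is the hook length of box $\square$ (arm + leg + 1), $H_\lambda=\prod_{\square\in\lambda}h_\square$, $H_\emptyset=1$. $f_{\lambda/\mu}$ is the number of standard Young tableaux of skew shape $\lambda/\mu$ ($f_{\mu/\mu}=1$). $S(\lambda,1)=\sum_{\square\in\lambda}(h_\square^2-1)$. -}

module Defs where

open import Data.Nat using (ℕ; _<?_; zero; suc; _+_; _*_; _∸_; _≤_; _<ᵇ_; _≤ᵇ_)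
open import Data.Bool using (Bool; true; false; _∧_; if_then_else_)
open import Data.List using (List; []; _∷_; length; map; concatMap; upTo; foldr; filter; _++_)
open import Data.Nat.ListAction using (sum; product)
open import Data.List.Properties using (≡-dec)
open import Data.Nat.Properties using () renaming (_≟_ to _≟ℕ_)
open import Data.Integer using (ℤ; +_)
open import Data.Rational using (ℚ; 0ℚ; _/_)
open import Data.Unit using (⊤)
open import Data.Product using (_×_; _,_; proj₁; proj₂)
open import Relation.Nullary.Decidable using (⌊_⌋)

IsPartition : List ℕ → Set
IsPartition [] = ⊤
IsPartition (a ∷ []) = 1 ≤ a
IsPartition (a ∷ b ∷ l) = b ≤ a × IsPartition (b ∷ l)

size : List ℕ → ℕ
size = sum

-- i-th row length (0-indexed), 0 beyond the last row
row : List ℕ → ℕ → ℕ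
row [] _ = 0
row (a ∷ l) zero = a
row (a ∷ l) (suc i) = row l i

col : List ℕ → ℕ → ℕ
col λ' j = length (filter (λ a → j <? a) λ')

cells : List ℕ → List (ℕ × ℕ)
cells λ' = concatMap (λ i → map (λ j → i , j) (upTo (row λ' i))) (upTo (length λ'))

-- hook length of cell (i , j): arm + leg + 1 = (λ_i - j - 1) + (λ'_j - i - 1) + 1
hook : List ℕ → ℕ → ℕ → ℕ
hook λ' i j = ((row λ' i ∸ j) + (col λ' j ∸ i)) ∸ 1

hooks : List ℕ → List ℕ
hooks λ' = map (λ c → hook λ' (proj₁ c) (proj₂ c)) (cells λ')

H : List ℕ → ℕ
H λ' = product (hooks λ')

-- S(λ,1) = Σ_{□ ∈ λ} (h_□² - 1)   (a natural number since h_□ ≥ 1)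
S1 : List ℕ → ℕ
S1 λ' = sum (map (λ h → h * h ∸ 1) (hooks λ'))

_⊆ᵇ_ : List ℕ → List ℕ → Bool
[] ⊆ᵇ _ = true
(a ∷ as) ⊆ᵇ [] = false
(a ∷ as) ⊆ᵇ (b ∷ bs) = (a ≤ᵇ b) ∧ (as ⊆ᵇ bs)

-- all partitions of n with largest part ≤ m (fuel f ≥ n guarantees completeness)
partsBounded : (fuel n m : ℕ) → List (List ℕ)
partsBounded _ zero _ = [] ∷ []
partsBounded zero (suc n) _ = []
partsBounded (suc f) (suc n) m =
  concatMap (λ k → if (suc k ≤ᵇ m) ∧ (suc k ≤ᵇ suc n)
                   then map (suc k ∷_) (partsBounded f (suc n ∸ suc k) (suc k))
                   else [])
            (upTo (suc n))

partitions : ℕ → List (List ℕ)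
partitions n = partsBounded n n n

addBox : List ℕ → List (List ℕ)
addBox [] = (1 ∷ []) ∷ []
addBox (a ∷ l) = ((suc a) ∷ l) ∷ map (a ∷_) (go a l)
  where
  -- add a box to some row of l, whose preceding row has length p
  go : ℕ → List ℕ → List (List ℕ)
  go p [] = (1 ∷ []) ∷ []
  go p (b ∷ r) = (if b <ᵇ p then (suc b ∷ r) ∷ [] else []) ++ map (b ∷_) (go b r)

chains : ℕ → List ℕ → List ℕ → ℕ
chains zero μ λ' = if ⌊ ≡-dec _≟ℕ_ μ λ' ⌋ then 1 else 0
chains (suc k) μ λ' = sum (map (λ ν → chains k ν λ') (addBox μ))

-- f_{λ/μ}: number of standard Young tableaux of skew shape λ/μ
-- (= number of saturated chains from μ to λ; 0 unless μ ⊆ λ; f_{μ/μ} = 1)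
f : List ℕ → List ℕ → ℕ
f λ' μ = chains (size λ' ∸ size μ) μ λ'

-- rational number p / q for q ≥ 1 (used only with q = H_λ ≥ 1; value 0 if q = 0)
frac : ℕ → ℕ → ℚ
frac p zero = 0ℚ
frac p (suc q) = (+ p) / suc q

sumℚ : List ℚ → ℚ
sumℚ = foldr Data.Rational._+_ 0ℚ

filterᵇ : {A : Set} → (A → Bool) → List A → List A
filterᵇ p [] = []
filterᵇ p (x ∷ xs) = if p x then x ∷ filterᵇ p xs else filterᵇ p xs

partitionsContaining : List ℕ → ℕ → List (List ℕ)
partitionsContaining μ n = filterᵇ (μ ⊆ᵇ_) (partitions n)

{-# OPTIONS --safe #-}
-- Since f_{λ/μ} counts the chains μ = ν₀ ⋖ ν₁ ⋖ ⋯ ⋖ ν_k = λ, the sum satisfies a recursion in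
-- k = n − |μ| whose step is the average Σ_{μ ⋖ ν} (H_μ / H_ν) g(c) over the box added, of content c,
-- i.e. an integral against Kerov's transition measure of μ. Adding a box of content c raises
-- S(·, 1) by c² + 2|μ|, and the transition measure has mass 1, mean 0 and second moment |μ|, so
-- the k-th step contributes 3(|μ| + k − 1) and the steps add up to (3/2) k (2|μ| + k − 1). The
-- moments are computed by induction on the rows, following how the first-row hooks change when a
-- box is added below; the induction also carries the Cauchy transform of the measure.
module Submission where

module RationalFacts where

  open import Data.Nat as ℕ using (ℕ; zero; suc)
  import Data.Nat.Properties as ℕ
  open import Data.Nat.ListAction using (sum)
  open import Data.Integer as ℤ using ()
  import Data.Integer.Properties as ℤ
  open import Data.Rational using (ℚ; mkℚ; _+_; _*_; _-_; -_; _/_; 0ℚ; 1ℚ; 1/_; ↥_; ≢-nonZero)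
  open import Data.Rational.Properties
  open import Data.Rational.Solver using (module +-*-Solver)
  import Data.Nat.Coprimality as Coprime
  open import Data.List using (List; []; _∷_; map; _++_; concatMap; applyUpTo)
  open import Data.List.Properties using (map-++)
  open import Data.List.Relation.Unary.All as All using (All; []; _∷_)
  import Data.List.Relation.Unary.All.Properties as All
  open import Function using (_∘_)
  open import Data.List.Relation.Binary.Permutation.Propositional using (_↭_; ↭⇒↭ₛ)
  open import Data.List.Relation.Binary.Permutation.Setoid.Properties using (foldr-commMonoid)
  open import Relation.Binary.PropositionalEquality
    using (_≡_; _≢_; refl; sym; trans; cong; cong₂; subst; module ≡-Reasoning)
  open import Relation.Nullary using (yes; no; ¬_)
  open import Data.Bool using (Bool; true; false; T; if_then_else_)
  open import Data.Empty using (⊥-elim)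
  open import Algebra.Bundles using (CommutativeMonoid)
  open import Defs using (sumℚ; frac; filterᵇ)

  open +-*-Solver

  cong₃ : ∀ {A B C D : Set} (f : A → B → C → D) {x x′ y y′ z z′} → x ≡ x′ → y ≡ y′ → z ≡ z′ → f x y z ≡ f x′ y′ z′
  cong₃ f refl refl refl = refl

  ι : ℕ → ℚ
  ι n = ℤ.+ n / 1

  private
    -- ι n in normal form, on which addition and multiplication compute
    ι′ : ℕ → ℚ
    ι′ n = mkℚ (ℤ.+ n) 0 (Coprime.sym (Coprime.1-coprimeTo n))

    ι≡ι′ : ∀ n → ι n ≡ ι′ n
    ι≡ι′ n = ↥p/↧p≡p (ι′ n)

  ι-+ : ∀ m n → ι (m ℕ.+ n) ≡ ι m + ι n
  ι-+ m n = begin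
    ℤ.+ (m ℕ.+ n) / 1
      ≡⟨ cong (_/ 1) (ℤ.pos-+ m n) ⟩
    (ℤ.+ m ℤ.+ ℤ.+ n) / 1
      ≡⟨ cong₂ (λ x y → (x ℤ.+ y) / 1) (ℤ.*-identityʳ (ℤ.+ m)) (ℤ.*-identityʳ (ℤ.+ n)) ⟨
    (ℤ.+ m ℤ.* ℤ.+ 1 ℤ.+ ℤ.+ n ℤ.* ℤ.+ 1) / 1
      ≡⟨ cong₂ _+_ (ι≡ι′ m) (ι≡ι′ n) ⟨
    ι m + ι n ∎
    where open ≡-Reasoning

  ι-* : ∀ m n → ι (m ℕ.* n) ≡ ι m * ι n
  ι-* m n = begin
    ℤ.+ (m ℕ.* n) / 1       ≡⟨ cong (_/ 1) (ℤ.pos-* m n) ⟩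
    (ℤ.+ m ℤ.* ℤ.+ n) / 1   ≡⟨ cong₂ _*_ (ι≡ι′ m) (ι≡ι′ n) ⟨
    ι m * ι n           ∎
    where open ≡-Reasoning

  ι-suc : ∀ n → ι (suc n) ≡ 1ℚ + ι n
  ι-suc = ι-+ 1

  ι-∸ : ∀ {m n} → n ℕ.≤ m → ι (m ℕ.∸ n) ≡ ι m - ι n
  ι-∸ {m} {n} n≤m = begin
    ι (m ℕ.∸ n)                  ≡⟨ solve 2 (λ x y → x := (x :+ y) :- y) refl (ι (m ℕ.∸ n)) (ι n) ⟩
    (ι (m ℕ.∸ n) + ι n) - ι n    ≡⟨ cong (_- ι n) (ι-+ (m ℕ.∸ n) n) ⟨
    ι (m ℕ.∸ n ℕ.+ n) - ι n      ≡⟨ cong (λ k → ι k - ι n) (ℕ.m∸n+n≡m n≤m) ⟩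
    ι m - ι n                    ∎
    where open ≡-Reasoning

  ι-split : ∀ {m n} → m ℕ.≤ n → ι n ≡ ι m + ι (n ℕ.∸ m)
  ι-split {m} {n} m≤n = trans (cong ι (sym (ℕ.m+[n∸m]≡n m≤n))) (ι-+ m (n ℕ.∸ m))

  ι-injective : ∀ {m n} → ι m ≡ ι n → m ≡ n
  ι-injective {m} {n} eq = ℤ.+-injective (cong ↥_ (trans (sym (ι≡ι′ m)) (trans eq (ι≡ι′ n))))

  ι[1+n]≢0 : ∀ n → ι (suc n) ≢ 0ℚ
  ι[1+n]≢0 n = ℕ.1+n≢0 ∘ ι-injective {suc n} {0}

  ι≢0 : ∀ {n} → 1 ℕ.≤ n → ι n ≢ 0ℚ
  ι≢0 {suc n} _ = ι[1+n]≢0 n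

  ι-sum : ∀ ns → ι (sum ns) ≡ sumℚ (map ι ns)
  ι-sum []       = refl
  ι-sum (n ∷ ns) = trans (ι-+ n (sum ns)) (cong (ι n +_) (ι-sum ns))

  -- A total inverse, with junk value 0ℚ ⁻¹ = 0ℚ.
  infix 9 _⁻¹
  _⁻¹ : ℚ → ℚ
  p ⁻¹ with p ≟ 0ℚ
  ... | yes _   = 0ℚ
  ... | no p≢0 = 1/_ p {{≢-nonZero p≢0}}

  ⁻¹-inverseʳ : ∀ {p} → p ≢ 0ℚ → p * p ⁻¹ ≡ 1ℚ
  ⁻¹-inverseʳ {p} p≢0 with p ≟ 0ℚ
  ... | yes p≡0  = ⊥-elim (p≢0 p≡0)
  ... | no p≢0′ = *-inverseʳ p {{≢-nonZero p≢0′}}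

  ⁻¹-inverseˡ : ∀ {p} → p ≢ 0ℚ → p ⁻¹ * p ≡ 1ℚ
  ⁻¹-inverseˡ {p} p≢0 = trans (*-comm (p ⁻¹) p) (⁻¹-inverseʳ p≢0)

  ⁻¹-unique : ∀ {p q} → p ≢ 0ℚ → p * q ≡ 1ℚ → q ≡ p ⁻¹
  ⁻¹-unique {p} {q} p≢0 pq≡1 = begin
    q                 ≡⟨ *-identityʳ q ⟨
    q * 1ℚ            ≡⟨ cong (q *_) (⁻¹-inverseʳ p≢0) ⟨
    q * (p * p ⁻¹)    ≡⟨ solve 3 (λ p q r → q :* (p :* r) := (p :* q) :* r) refl p q (p ⁻¹) ⟩
    (p * q) * p ⁻¹    ≡⟨ cong (_* p ⁻¹) pq≡1 ⟩
    1ℚ * p ⁻¹         ≡⟨ *-identityˡ (p ⁻¹) ⟩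
    p ⁻¹              ∎
    where open ≡-Reasoning

  *-≢0 : ∀ {p q} → p ≢ 0ℚ → q ≢ 0ℚ → p * q ≢ 0ℚ
  *-≢0 {p} {q} p≢0 q≢0 pq≡0 = p≢0 (begin
    p                 ≡⟨ *-identityʳ p ⟨
    p * 1ℚ            ≡⟨ cong (p *_) (⁻¹-inverseʳ q≢0) ⟨
    p * (q * q ⁻¹)    ≡⟨ *-assoc p q (q ⁻¹) ⟨
    (p * q) * q ⁻¹    ≡⟨ cong (_* q ⁻¹) pq≡0 ⟩
    0ℚ * q ⁻¹         ≡⟨ *-zeroˡ (q ⁻¹) ⟩
    0ℚ                ∎)
    where open ≡-Reasoning

  ⁻¹-distrib-* : ∀ {p q} → p ≢ 0ℚ → q ≢ 0ℚ → (p * q) ⁻¹ ≡ p ⁻¹ * q ⁻¹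
  ⁻¹-distrib-* {p} {q} p≢0 q≢0 = sym (⁻¹-unique (*-≢0 p≢0 q≢0) (begin
    (p * q) * (p ⁻¹ * q ⁻¹)
      ≡⟨ solve 4 (λ p q r s → (p :* q) :* (r :* s) := (p :* r) :* (q :* s)) refl p q (p ⁻¹) (q ⁻¹) ⟩
    (p * p ⁻¹) * (q * q ⁻¹)
      ≡⟨ cong₂ _*_ (⁻¹-inverseʳ p≢0) (⁻¹-inverseʳ q≢0) ⟩
    1ℚ ∎))
    where open ≡-Reasoning

  *-⁻¹-cancelʳ : ∀ p {q r} → q ≢ 0ℚ → r ≢ 0ℚ → (p * r) * (q * r) ⁻¹ ≡ p * q ⁻¹
  *-⁻¹-cancelʳ p {q} {r} q≢0 r≢0 = begin
    (p * r) * (q * r) ⁻¹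
      ≡⟨ cong ((p * r) *_) (⁻¹-distrib-* q≢0 r≢0) ⟩
    (p * r) * (q ⁻¹ * r ⁻¹)
      ≡⟨ solve 4 (λ p r s t → (p :* r) :* (s :* t) := (p :* s) :* (r :* t)) refl p r (q ⁻¹) (r ⁻¹) ⟩
    (p * q ⁻¹) * (r * r ⁻¹)
      ≡⟨ cong ((p * q ⁻¹) *_) (⁻¹-inverseʳ r≢0) ⟩
    (p * q ⁻¹) * 1ℚ
      ≡⟨ *-identityʳ _ ⟩
    p * q ⁻¹ ∎
    where open ≡-Reasoning

  1-ι[1+n]⁻¹ : ∀ n → 1ℚ - ι (suc n) ⁻¹ ≡ ι n * ι (suc n) ⁻¹
  1-ι[1+n]⁻¹ n = begin
    1ℚ - ι (suc n) ⁻¹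
      ≡⟨ cong (_- ι (suc n) ⁻¹) (⁻¹-inverseʳ (ι[1+n]≢0 n)) ⟨
    ι (suc n) * ι (suc n) ⁻¹ - ι (suc n) ⁻¹
      ≡⟨ cong (λ x → x * ι (suc n) ⁻¹ - ι (suc n) ⁻¹) (ι-suc n) ⟩
    (1ℚ + ι n) * ι (suc n) ⁻¹ - ι (suc n) ⁻¹
      ≡⟨ solve 2 (λ x v → (con 1ℚ :+ x) :* v :- v := x :* v) refl (ι n) (ι (suc n) ⁻¹) ⟩
    ι n * ι (suc n) ⁻¹ ∎
    where open ≡-Reasoning

  /-suc≡*⁻¹ : ∀ p q → ℤ.+ p / suc q ≡ ι p * ι (suc q) ⁻¹
  /-suc≡*⁻¹ p q = begin
    ℤ.+ p / suc q                         ≡⟨ /-cong (ℤ.*-identityʳ (ℤ.+ p)) (ℕ.*-identityˡ (suc q)) ⟨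
    (ℤ.+ p ℤ.* ℤ.+ 1) / (1 ℕ.* suc q)     ≡⟨⟩
    ι′ p * ι′ (suc q) ⁻¹                  ≡⟨ cong₂ (λ x y → x * y ⁻¹) (ι≡ι′ p) (ι≡ι′ (suc q)) ⟨
    ι p * ι (suc q) ⁻¹                    ∎
    where open ≡-Reasoning

  frac≡*⁻¹ : ∀ p q → frac p q ≡ ι p * ι q ⁻¹
  frac≡*⁻¹ p zero    = sym (*-zeroʳ (ι p))
  frac≡*⁻¹ p (suc q) = /-suc≡*⁻¹ p q

  sumℚ-++ : ∀ ps qs → sumℚ (ps ++ qs) ≡ sumℚ ps + sumℚ qs
  sumℚ-++ []       qs = sym (+-identityˡ _)
  sumℚ-++ (p ∷ ps) qs = trans (cong (p +_) (sumℚ-++ ps qs)) (sym (+-assoc p _ _))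

  sumℚ-↭ : ∀ {ps qs} → ps ↭ qs → sumℚ ps ≡ sumℚ qs
  sumℚ-↭ ps↭qs = foldr-commMonoid setoid isCommutativeMonoid (↭⇒↭ₛ ps↭qs)
    where open CommutativeMonoid +-0-commutativeMonoid

  sumℚ-zero : ∀ {qs} → All (_≡ 0ℚ) qs → sumℚ qs ≡ 0ℚ
  sumℚ-zero []               = refl
  sumℚ-zero (q≡0 ∷ qs≡0) = trans (cong₂ _+_ q≡0 (sumℚ-zero qs≡0)) (+-identityˡ 0ℚ)

  private
    variable
      A B : Set

  sumℚ-map-+ : ∀ (f g : A → ℚ) xs →
               sumℚ (map (λ x → f x + g x) xs) ≡ sumℚ (map f xs) + sumℚ (map g xs)
  sumℚ-map-+ f g []       = refl
  sumℚ-map-+ f g (x ∷ xs) = trans (cong (f x + g x +_) (sumℚ-map-+ f g xs))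
    (solve 4 (λ a b c d → (a :+ b) :+ (c :+ d) := (a :+ c) :+ (b :+ d)) refl
           (f x) (g x) (sumℚ (map f xs)) (sumℚ (map g xs)))

  sumℚ-map-*ˡ : ∀ k (f : A → ℚ) xs → sumℚ (map (λ x → k * f x) xs) ≡ k * sumℚ (map f xs)
  sumℚ-map-*ˡ k f []       = sym (*-zeroʳ k)
  sumℚ-map-*ˡ k f (x ∷ xs) =
    trans (cong (k * f x +_) (sumℚ-map-*ˡ k f xs)) (sym (*-distribˡ-+ k (f x) _))

  sumℚ-map-*ʳ : ∀ (f : A → ℚ) k xs → sumℚ (map (λ x → f x * k) xs) ≡ sumℚ (map f xs) * k
  sumℚ-map-*ʳ f k []       = sym (*-zeroˡ k)
  sumℚ-map-*ʳ f k (x ∷ xs) =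
    trans (cong (f x * k +_) (sumℚ-map-*ʳ f k xs)) (sym (*-distribʳ-+ k (f x) _))

  sumℚ-concatMap : ∀ (f : B → ℚ) (g : A → List B) xs →
                   sumℚ (map f (concatMap g xs)) ≡ sumℚ (map (λ x → sumℚ (map f (g x))) xs)
  sumℚ-concatMap f g []       = refl
  sumℚ-concatMap f g (x ∷ xs) = begin
    sumℚ (map f (g x ++ concatMap g xs))
      ≡⟨ cong sumℚ (map-++ f (g x) (concatMap g xs)) ⟩
    sumℚ (map f (g x) ++ map f (concatMap g xs))
      ≡⟨ sumℚ-++ (map f (g x)) _ ⟩
    sumℚ (map f (g x)) + sumℚ (map f (concatMap g xs))
      ≡⟨ cong (sumℚ (map f (g x)) +_) (sumℚ-concatMap f g xs) ⟩
    sumℚ (map f (g x)) + sumℚ (map (λ x → sumℚ (map f (g x))) xs) ∎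
    where open ≡-Reasoning

  sumℚ-swap : ∀ (g : A → B → ℚ) xs ys →
              sumℚ (map (λ x → sumℚ (map (g x) ys)) xs) ≡ sumℚ (map (λ y → sumℚ (map (λ x → g x y) xs)) ys)
  sumℚ-swap g []       ys = sym (sumℚ-zero (All.map⁺ (All.tabulate {xs = ys} (λ _ → refl))))
  sumℚ-swap g (x ∷ xs) ys = trans (cong (sumℚ (map (g x) ys) +_) (sumℚ-swap g xs ys))
                                  (sym (sumℚ-map-+ (g x) _ ys))

  sumℚ-filterᵇ : ∀ (p : A → Bool) (g : A → ℚ) xs → (∀ x → ¬ T (p x) → g x ≡ 0ℚ) →
                 sumℚ (map g (filterᵇ p xs)) ≡ sumℚ (map g xs)
  sumℚ-filterᵇ p g []       g≡0 = refl
  sumℚ-filterᵇ p g (x ∷ xs) g≡0 = byCases (p x) refl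
    where
    byCases : ∀ b → p x ≡ b → sumℚ (map g (if b then x ∷ filterᵇ p xs else filterᵇ p xs)) ≡ g x + sumℚ (map g xs)
    byCases true  _     = cong (g x +_) (sumℚ-filterᵇ p g xs g≡0)
    byCases false px≡ff = trans (sumℚ-filterᵇ p g xs g≡0) (trans (sym (+-identityˡ _))
                            (cong (_+ sumℚ (map g xs)) (sym (g≡0 x (λ px → subst T px≡ff px)))))

  sumℚ-applyUpTo-single : ∀ (h : ℕ → ℚ) {n k} → k ℕ.< n → (∀ {i} → i ℕ.< n → i ≢ k → h i ≡ 0ℚ) →
                          sumℚ (applyUpTo h n) ≡ h k
  sumℚ-applyUpTo-single h {suc n} {zero}  _ h≡0 = begin
    h 0 + sumℚ (applyUpTo (h ∘ suc) n)
      ≡⟨ cong (h 0 +_) (sumℚ-zero (All.applyUpTo⁺₁ (h ∘ suc) n (λ i<n → h≡0 (ℕ.s≤s i<n) (λ ())))) ⟩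
    h 0 + 0ℚ
      ≡⟨ +-identityʳ (h 0) ⟩
    h 0 ∎
    where open ≡-Reasoning
  sumℚ-applyUpTo-single h {suc n} {suc k} (ℕ.s≤s k<n) h≡0 = trans
    (cong (_+ sumℚ (applyUpTo (h ∘ suc) n)) (h≡0 (ℕ.s≤s ℕ.z≤n) (λ ())))
    (trans (+-identityˡ _) (sumℚ-applyUpTo-single (h ∘ suc) k<n (λ i<n i≢k → h≡0 (ℕ.s≤s i<n) (i≢k ∘ ℕ.suc-injective))))

module Hooks where

  open import Data.Nat using (ℕ; zero; suc; _+_; _*_; _∸_; _≤_; _<_; _<?_; z≤n; s≤s)
  open import Data.Nat.Properties
  open import Data.Nat.ListAction using (sum; product)
  open import Data.Nat.ListAction.Properties using (sum-++; product-++)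
  open import Data.List using (List; []; _∷_; map; _++_; concat; concatMap; applyUpTo; applyDownFrom; upTo; length)
  open import Data.List.Properties using (map-++; map-∘; map-concatMap; map-applyUpTo; filter-accept; filter-reject)
  open import Data.List.Relation.Unary.All as All using (All; []; _∷_)
  import Data.List.Relation.Unary.All.Properties as All
  open import Data.List.Relation.Binary.Permutation.Propositional using (_↭_; ↭-refl; module PermutationReasoning)
  open import Data.Product using (_×_; _,_)
  open import Data.Sum using (inj₁; inj₂)
  open import Function using (_∘_)
  open import Relation.Binary.PropositionalEquality
  open import Relation.Nullary.Negation using (contradiction)
  open import Defs

  IsPartition-tail : ∀ {a l} → IsPartition (a ∷ l) → IsPartition l
  IsPartition-tail {l = []}    _       = _
  IsPartition-tail {l = _ ∷ _} (_ , p) = p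

  IsPartition-head>0 : ∀ {a l} → IsPartition (a ∷ l) → 1 ≤ a
  IsPartition-head>0 {l = []}    p         = p
  IsPartition-head>0 {l = _ ∷ _} (b≤a , p) = ≤-trans (IsPartition-head>0 p) b≤a

  IsPartition-rows≤head : ∀ {a l} → IsPartition (a ∷ l) → All (_≤ a) l
  IsPartition-rows≤head {l = []}    _         = []
  IsPartition-rows≤head {l = _ ∷ _} (b≤a , p) = b≤a ∷ All.map (λ c≤b → ≤-trans c≤b b≤a) (IsPartition-rows≤head p)

  IsPartition-raiseHead : ∀ {a b l} → IsPartition (a ∷ l) → a ≤ b → IsPartition (b ∷ l)
  IsPartition-raiseHead {l = []}    p         a≤b = ≤-trans p a≤b
  IsPartition-raiseHead {l = _ ∷ _} (c≤a , p) a≤b = ≤-trans c≤a a≤b , p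

  row≤ : ∀ {a l} → All (_≤ a) l → ∀ i → row l i ≤ a
  row≤ []          i       = z≤n
  row≤ (b≤a ∷ _)   zero    = b≤a
  row≤ (_ ∷ l≤a)   (suc i) = row≤ l≤a i

  col-∷-< : ∀ {a j} l → j < a → col (a ∷ l) j ≡ suc (col l j)
  col-∷-< {a} {j} l j<a = cong length (filter-accept (j <?_) j<a)

  col-∷-≥ : ∀ {a j} l → a ≤ j → col (a ∷ l) j ≡ col l j
  col-∷-≥ {a} {j} l a≤j = cong length (filter-reject (j <?_) (≤⇒≯ a≤j))

  col-≥ : ∀ {b l} → All (_≤ b) l → ∀ {j} → b ≤ j → col l j ≡ 0
  col-≥ []            b≤j = refl
  col-≥ (a≤b ∷ l≤b) {j} b≤j = trans (col-∷-≥ _ (≤-trans a≤b b≤j)) (col-≥ l≤b b≤j)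

  -- rowHooks k j l lists the hook lengths, in the diagram (j + k) ∷ l, of the first-row
  -- cells in columns j, …, j + k − 1.
  rowHooks : ℕ → ℕ → List ℕ → List ℕ
  rowHooks zero    j l = []
  rowHooks (suc k) j l = suc k + col l j ∷ rowHooks k (suc j) l

  rowHooks-pos : ∀ k j l → All (1 ≤_) (rowHooks k j l)
  rowHooks-pos zero    j l = []
  rowHooks-pos (suc k) j l = s≤s z≤n ∷ rowHooks-pos k (suc j) l

  rowHooks-legless : ∀ k {j l} → (∀ {i} → j ≤ i → col l i ≡ 0) → rowHooks k j l ≡ applyDownFrom suc k
  rowHooks-legless zero    col≡0 = refl
  rowHooks-legless (suc k) {j} col≡0 =
    cong₂ _∷_ (trans (cong (suc k +_) (col≡0 ≤-refl)) (+-identityʳ (suc k)))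
              (rowHooks-legless k (λ j<i → col≡0 (≤-trans (n≤1+n j) j<i)))

  -- Shortening the first row from a + 1 to a cells (a = j + k) while inserting a row of length b
  -- below it keeps the hooks in columns < b and shifts those in columns ≥ b by one cell, so only
  -- the hook a + 1 − b is lost.
  rowHooks-↭ : ∀ {b ν} → All (_≤ b) ν → ∀ k j → j ≤ b → b ≤ j + k →
               rowHooks (suc k) j ν ↭ (suc (j + k) ∸ b) ∷ rowHooks k j (b ∷ ν)
  rowHooks-↭ {b} {ν} ν≤b k j j≤b b≤j+k with m≤n⇒m<n∨m≡n j≤b
  ... | inj₂ refl = begin
    rowHooks (suc k) j ν          ≡⟨ rowHooks-legless (suc k) (col-≥ ν≤b) ⟩
    suc k ∷ applyDownFrom suc k   ≡⟨ cong₂ _∷_ (m+n∸m≡n j (suc k)) (rowHooks-legless k col-∷ν≡0) ⟨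
    (j + suc k ∸ j) ∷ rowHooks k j (j ∷ ν)  ≡⟨ cong (λ x → x ∸ j ∷ rowHooks k j (j ∷ ν)) (+-suc j k) ⟩
    (suc (j + k) ∸ j) ∷ rowHooks k j (j ∷ ν) ∎
    where
    open PermutationReasoning
    col-∷ν≡0 : ∀ {i} → j ≤ i → col (j ∷ ν) i ≡ 0
    col-∷ν≡0 j≤i = trans (col-∷-≥ ν j≤i) (col-≥ ν≤b j≤i)
  rowHooks-↭ ν≤b zero    j _ b≤j+0 | inj₁ j<b = contradiction (subst (_ ≤_) (+-identityʳ j) b≤j+0) (<⇒≱ j<b)
  rowHooks-↭ {b} {ν} ν≤b (suc k) j _ b≤j+1+k | inj₁ j<b = begin
    h ∷ rowHooks (suc k) (suc j) ν
      <⟨ rowHooks-↭ ν≤b k (suc j) j<b (subst (b ≤_) (+-suc j k) b≤j+1+k) ⟩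
    h ∷ (suc (suc j + k) ∸ b) ∷ rowHooks k (suc j) (b ∷ ν)
      <<⟨ ↭-refl ⟩
    (suc (suc j + k) ∸ b) ∷ h ∷ rowHooks k (suc j) (b ∷ ν)
      ≡⟨ cong₂ (λ x y → x ∸ b ∷ y ∷ rowHooks k (suc j) (b ∷ ν)) (cong suc (sym (+-suc j k))) h≡ ⟩
    (suc (j + suc k) ∸ b) ∷ rowHooks (suc k) j (b ∷ ν) ∎
    where
    open PermutationReasoning
    h = suc (suc k) + col ν j
    h≡ : h ≡ suc k + col (b ∷ ν) j
    h≡ = trans (sym (+-suc (suc k) (col ν j))) (cong (suc k +_) (sym (col-∷-< ν j<b)))

  applyUpTo-cong-< : ∀ {A : Set} {f g : ℕ → A} n → (∀ {i} → i < n → f i ≡ g i) → applyUpTo f n ≡ applyUpTo g n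
  applyUpTo-cong-< zero    f≡g = refl
  applyUpTo-cong-< (suc n) f≡g = cong₂ _∷_ (f≡g (s≤s z≤n)) (applyUpTo-cong-< n (f≡g ∘ s≤s))

  hooks-byRow : ∀ λ′ → hooks λ′ ≡ concat (applyUpTo (λ i → applyUpTo (hook λ′ i) (row λ′ i)) (length λ′))
  hooks-byRow λ′ = begin
    map hook′ (concatMap cellsOfRow (upTo (length λ′)))
      ≡⟨ map-concatMap hook′ cellsOfRow (upTo (length λ′)) ⟩
    concat (map (map hook′ ∘ cellsOfRow) (upTo (length λ′)))
      ≡⟨ cong concat (map-applyUpTo (λ i → i) (map hook′ ∘ cellsOfRow) (length λ′)) ⟩
    concat (applyUpTo (map hook′ ∘ cellsOfRow) (length λ′))
      ≡⟨ cong concat (applyUpTo-cong-< (length λ′) (λ {i} _ → rowOfHooks i)) ⟩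
    concat (applyUpTo (λ i → applyUpTo (hook λ′ i) (row λ′ i)) (length λ′)) ∎
    where
    open ≡-Reasoning
    hook′ : ℕ × ℕ → ℕ
    hook′ (i , j) = hook λ′ i j
    cellsOfRow : ℕ → List (ℕ × ℕ)
    cellsOfRow i = map (i ,_) (upTo (row λ′ i))
    rowOfHooks : ∀ i → map hook′ (cellsOfRow i) ≡ applyUpTo (hook λ′ i) (row λ′ i)
    rowOfHooks i = trans (sym (map-∘ (upTo (row λ′ i)))) (map-applyUpTo (λ j → j) (hook λ′ i) (row λ′ i))

  rowHooks≡applyUpTo : ∀ k j l → rowHooks k j l ≡ applyUpTo (λ i → (k ∸ i) + col l (j + i)) k
  rowHooks≡applyUpTo zero    j l = refl
  rowHooks≡applyUpTo (suc k) j l = cong₂ _∷_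
    (cong (λ i → suc k + col l i) (sym (+-identityʳ j)))
    (trans (rowHooks≡applyUpTo k (suc j) l) (applyUpTo-cong-< k (λ {i} _ → cong (λ x → (k ∸ i) + col l x) (sym (+-suc j i)))))

  hooks-∷ : ∀ {a l} → IsPartition (a ∷ l) → hooks (a ∷ l) ≡ rowHooks a 0 l ++ hooks l
  hooks-∷ {a} {l} p = begin
    hooks (a ∷ l)
      ≡⟨ hooks-byRow (a ∷ l) ⟩
    applyUpTo (hook (a ∷ l) 0) a ++ concat (applyUpTo (λ i → applyUpTo (hook (a ∷ l) (suc i)) (row l i)) (length l))
      ≡⟨ cong₂ _++_ (applyUpTo-cong-< a firstRow) (cong concat (applyUpTo-cong-< (length l) (λ _ → applyUpTo-cong-< _ (lowerRows _)))) ⟩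
    applyUpTo (λ j → (a ∸ j) + col l j) a ++ concat (applyUpTo (λ i → applyUpTo (hook l i) (row l i)) (length l))
      ≡⟨ cong₂ _++_ (rowHooks≡applyUpTo a 0 l) (hooks-byRow l) ⟨
    rowHooks a 0 l ++ hooks l ∎
    where
    open ≡-Reasoning
    firstRow : ∀ {j} → j < a → hook (a ∷ l) 0 j ≡ (a ∸ j) + col l j
    firstRow {j} j<a = trans (cong (λ c → (a ∸ j + c) ∸ 1) (col-∷-< l j<a)) (cong (_∸ 1) (+-suc (a ∸ j) (col l j)))
    lowerRows : ∀ i {j} → j < row l i → hook (a ∷ l) (suc i) j ≡ hook l i j
    lowerRows i {j} j<lᵢ = cong (λ c → (row l i ∸ j + (c ∸ suc i)) ∸ 1)
                                (col-∷-< l (<-≤-trans j<lᵢ (row≤ (IsPartition-rows≤head p) i)))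

  H-∷ : ∀ {a l} → IsPartition (a ∷ l) → H (a ∷ l) ≡ product (rowHooks a 0 l) * H l
  H-∷ {a} {l} p = trans (cong product (hooks-∷ p)) (product-++ (rowHooks a 0 l) (hooks l))

  S1-∷ : ∀ {a l} → IsPartition (a ∷ l) → S1 (a ∷ l) ≡ sum (map (λ h → h * h ∸ 1) (rowHooks a 0 l)) + S1 l
  S1-∷ {a} {l} p = begin
    sum (map sq-1 (hooks (a ∷ l)))
      ≡⟨ cong (sum ∘ map sq-1) (hooks-∷ p) ⟩
    sum (map sq-1 (rowHooks a 0 l ++ hooks l))
      ≡⟨ cong sum (map-++ sq-1 (rowHooks a 0 l) (hooks l)) ⟩
    sum (map sq-1 (rowHooks a 0 l) ++ map sq-1 (hooks l))
      ≡⟨ sum-++ (map sq-1 (rowHooks a 0 l)) _ ⟩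
    sum (map sq-1 (rowHooks a 0 l)) + S1 l ∎
    where
    open ≡-Reasoning
    sq-1 : ℕ → ℕ
    sq-1 h = h * h ∸ 1

  product-pos : ∀ {ns} → All (1 ≤_) ns → 1 ≤ product ns
  product-pos []         = ≤-refl
  product-pos (n≥1 ∷ ns) = *-mono-≤ n≥1 (product-pos ns)

  H-pos : ∀ {μ} → IsPartition μ → 1 ≤ H μ
  H-pos {[]}    _ = ≤-refl
  H-pos {a ∷ l} p = subst (1 ≤_) (sym (H-∷ p)) (*-mono-≤ (product-pos (rowHooks-pos a 0 l)) (H-pos (IsPartition-tail p)))

module OuterCorners where

  open import Data.Nat as ℕ using (ℕ; zero; suc; _∸_; _≤_; _<_; _<ᵇ_; z≤n; s≤s)
  import Data.Nat.Properties as ℕ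
  open import Data.Rational using (ℚ; 0ℚ; 1ℚ; _+_; _-_)
  import Data.Rational.Properties as ℚ
  open import Data.Rational.Solver using (module +-*-Solver)
  open import Data.Bool using (true; false; if_then_else_)
  open import Data.List using (List; []; _∷_; map; _++_; applyDownFrom)
  open import Data.List.Properties using (map-∘; map-++; ∷-injectiveʳ)
  open import Data.List.Relation.Unary.All as All using (All; []; _∷_)
  import Data.List.Relation.Unary.All.Properties as All
  open import Data.List.Relation.Unary.Any using (here; there)
  open import Data.List.Membership.Propositional.Properties using (∈-∃++)
  open import Data.List.Relation.Binary.Permutation.Propositional
    using (_↭_; ↭-refl; ↭-reflexive; ↭-sym; ↭-trans; ↭-prep; ↭-swap)
  open import Data.List.Relation.Binary.Permutation.Propositional.Properties using (∈-resp-↭; shift; drop-∷)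
  open import Data.Product using (Σ-syntax; _×_; _,_; proj₁; proj₂)
  open import Relation.Binary.PropositionalEquality
  open import Relation.Nullary.Negation using (contradiction)
  open import Relation.Nullary.Reflects using (Reflects; ofʸ; ofⁿ)
  open import Defs
  open RationalFacts
  open Hooks

  ↭-cancel : ∀ {A : Set} {u d : A} {L M} → u ≢ d → u ∷ L ↭ d ∷ M → Σ[ X ∈ List A ] (L ↭ d ∷ X × M ↭ u ∷ X)
  ↭-cancel {u = u} {d} {M = M} u≢d u∷L↭d∷M with ∈-resp-↭ (↭-sym u∷L↭d∷M) (here refl)
  ... | here d≡u = contradiction (sym d≡u) u≢d
  ... | there d∈L with ∈-∃++ d∈L
  ...   | xs , ys , refl = xs ++ ys , shift d xs ys ,
    drop-∷ (↭-trans (↭-sym u∷L↭d∷M) (↭-trans (↭-prep u (shift d xs ys)) (↭-swap u d ↭-refl)))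

  -- An outer corner of a diagram μ: the diagram μ + □, and the content of □.
  Corner : Set
  Corner = List ℕ × ℚ

  diagram : Corner → List ℕ
  diagram = proj₁

  content : Corner → ℚ
  content = proj₂

  shiftDown : ℕ → Corner → Corner
  shiftDown a (λ′ , c) = a ∷ λ′ , c - 1ℚ

  -- The outer corners of l that remain outer corners of p ∷ l, with contents measured in l.
  outerCornersUnder : ℕ → List ℕ → List Corner
  outerCornersUnder p []      = (1 ∷ [] , 0ℚ) ∷ []
  outerCornersUnder p (b ∷ l) =
    (if b <ᵇ p then (suc b ∷ l , ι b) ∷ [] else []) ++ map (shiftDown b) (outerCornersUnder b l)

  outerCorners : List ℕ → List Corner
  outerCorners []      = (1 ∷ [] , 0ℚ) ∷ []
  outerCorners (a ∷ l) = (suc a ∷ l , ι a) ∷ map (shiftDown a) (outerCornersUnder a l)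

  map-diagram-shiftDown : ∀ a cs → map diagram (map (shiftDown a) cs) ≡ map (a ∷_) (map diagram cs)
  map-diagram-shiftDown a cs = trans (sym (map-∘ cs)) (map-∘ cs)

  map-diagram-outerCorners : ∀ μ → map diagram (outerCorners μ) ≡ addBox μ
  map-diagram-outerCorners []          = refl
  map-diagram-outerCorners (a ∷ [])    = refl
  map-diagram-outerCorners (a ∷ b ∷ l) = cong ((suc a ∷ b ∷ l) ∷_) (trans (map-diagram-shiftDown a _)
    (cong (map (a ∷_)) (trans (map-++ diagram (if b <ᵇ a then (suc b ∷ l , ι b) ∷ [] else []) _)
      (cong₂ _++_ (map-diagram-if (b <ᵇ a)) (∷-injectiveʳ (map-diagram-outerCorners (b ∷ l)))))))
    where
    map-diagram-if : ∀ t → map diagram (if t then (suc b ∷ l , ι b) ∷ [] else []) ≡ (if t then (suc b ∷ l) ∷ [] else [])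
    map-diagram-if true  = refl
    map-diagram-if false = refl

  Raises : ℕ → List ℕ → List ℕ → Set
  Raises d L M = Σ[ X ∈ List ℕ ] (L ↭ d ∷ X × M ↭ suc d ∷ X)

  -- For every a ≥ p, adding the box of κ (of content c) to l raises the first-row hook a − c of
  -- a ∷ l by one and leaves the other first-row hooks alone.
  RaisesFirstRowHook : ℕ → List ℕ → Corner → Set
  RaisesFirstRowHook p l κ =
    ∀ a → p ≤ a → Σ[ d ∈ ℕ ] (ι a ≡ content κ + ι d × Raises d (rowHooks a 0 l) (rowHooks a 0 (diagram κ)))

  -- Contents are integers stored in ℚ: c < p is expressed as ι p ≡ c + ι (suc k),
  -- and c ≤ a as ι a ≡ c + ι d.
  record IsCornerUnder (p : ℕ) (l : List ℕ) (κ : Corner) : Set where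
    field
      isPartition : IsPartition (p ∷ diagram κ)
      size≡       : size (diagram κ) ≡ suc (size l)
      content<    : Σ[ k ∈ ℕ ] ι p ≡ content κ + ι (suc k)
      raises      : RaisesFirstRowHook p l κ

  record IsCorner (μ : List ℕ) (κ : Corner) : Set where
    field
      isPartition : IsPartition (diagram κ)
      size≡       : size (diagram κ) ≡ suc (size μ)
      content≤    : ∀ a → row μ 0 ≤ a → Σ[ d ∈ ℕ ] ι a ≡ content κ + ι d

  open +-*-Solver

  -- The content of a box drops by one when a row is inserted above it.
  ι-shiftContent : ∀ c a k n → ι a ≡ c + ι k → ι (a ℕ.+ n) ≡ (c - 1ℚ) + ι (suc k ℕ.+ n)
  ι-shiftContent c a k n a≡c+k = begin
    ι (a ℕ.+ n)
      ≡⟨ ι-+ a n ⟩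
    ι a + ι n
      ≡⟨ cong (_+ ι n) a≡c+k ⟩
    (c + ι k) + ι n
      ≡⟨ solve 3 (λ c k n → (c :+ k) :+ n := (c :- con 1ℚ) :+ (con 1ℚ :+ (k :+ n))) refl c (ι k) (ι n) ⟩
    (c - 1ℚ) + (1ℚ + (ι k + ι n))
      ≡⟨ cong (λ x → (c - 1ℚ) + (1ℚ + x)) (ι-+ k n) ⟨
    (c - 1ℚ) + (1ℚ + ι (k ℕ.+ n))
      ≡⟨ cong ((c - 1ℚ) +_) (ι-suc (k ℕ.+ n)) ⟨
    (c - 1ℚ) + ι (suc k ℕ.+ n) ∎
    where open ≡-Reasoning

  ι-pred : ∀ c a d → ι (suc a) ≡ c + ι d → ι a ≡ (c - 1ℚ) + ι d
  ι-pred c a d 1+a≡c+d = begin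
    ι a                  ≡⟨ solve 1 (λ x → x := (con 1ℚ :+ x) :- con 1ℚ) refl (ι a) ⟩
    (1ℚ + ι a) - 1ℚ      ≡⟨ cong (_- 1ℚ) (trans (sym (ι-suc a)) 1+a≡c+d) ⟩
    (c + ι d) - 1ℚ       ≡⟨ solve 2 (λ c x → (c :+ x) :- con 1ℚ := (c :- con 1ℚ) :+ x) refl c (ι d) ⟩
    (c - 1ℚ) + ι d       ∎
    where open ≡-Reasoning

  raises-empty : ∀ {p} → 1 ≤ p → RaisesFirstRowHook p [] (1 ∷ [] , 0ℚ)
  raises-empty p≥1 zero    p≤0 = contradiction (ℕ.≤-trans p≥1 p≤0) λ ()
  raises-empty _   (suc a) _   = suc a , sym (ℚ.+-identityˡ _) , applyDownFrom suc a ,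
    ↭-reflexive (rowHooks-legless (suc a) (λ _ → refl)) ,
    ↭-reflexive (cong₂ _∷_ (ℕ.+-comm (suc a) 1) (rowHooks-legless a (λ 1≤i → col-∷-≥ [] 1≤i)))

  raises-growRow : ∀ {p b l} → IsPartition (b ∷ l) → b < p → RaisesFirstRowHook p (b ∷ l) (suc b ∷ l , ι b)
  raises-growRow {p} {b} {l} pl b<p a p≤a =
    a ∸ b , ι-split b≤a , ↭-cancel (ℕ.1+n≢n {a ∸ b}) (↭-trans (↭-sym long↭short) long↭grown)
    where
    b<a = ℕ.<-≤-trans b<p p≤a
    b≤a = ℕ.<⇒≤ b<a
    l≤b = IsPartition-rows≤head pl
    long↭short : rowHooks (suc a) 0 l ↭ suc (a ∸ b) ∷ rowHooks a 0 (b ∷ l)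
    long↭short = subst (λ h → rowHooks (suc a) 0 l ↭ h ∷ rowHooks a 0 (b ∷ l))
                       (ℕ.+-∸-assoc 1 b≤a) (rowHooks-↭ l≤b a 0 z≤n b≤a)
    long↭grown : rowHooks (suc a) 0 l ↭ a ∸ b ∷ rowHooks a 0 (suc b ∷ l)
    long↭grown = rowHooks-↭ (All.map (λ c≤b → ℕ.≤-trans c≤b (ℕ.n≤1+n b)) l≤b) a 0 z≤n b<a

  content<⇒hook≢ : ∀ a b c k d → b ≤ suc a → ι b ≡ c + ι (suc k) → ι (suc a) ≡ c + ι d → suc a ∸ b ≢ d
  content<⇒hook≢ a b c k d b≤1+a b≡c+1+k 1+a≡c+d u≡d = ι[1+n]≢0 k (begin
    ι (suc k)
      ≡⟨ solve 3 (λ s c x → s := (c :+ s) :+ (x :- (c :+ x))) refl (ι (suc k)) c (ι u) ⟩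
    (c + ι (suc k)) + (ι u - (c + ι u))
      ≡⟨ cong₂ (λ x y → x + (ι u - (c + ι y))) (sym b≡c+1+k) u≡d ⟩
    ι b + (ι u - (c + ι d))
      ≡⟨ cong (λ x → ι b + (ι u - x)) (trans (sym (ι-split b≤1+a)) 1+a≡c+d) ⟨
    ι b + (ι u - (ι b + ι u))
      ≡⟨ solve 2 (λ x y → x :+ (y :- (x :+ y)) := con 0ℚ) refl (ι b) (ι u) ⟩
    0ℚ ∎)
    where
    open ≡-Reasoning
    u = suc a ∸ b

  raises-shiftDown : ∀ {p b l κ} → b ≤ p → IsPartition (b ∷ l) → IsPartition (b ∷ diagram κ) →
                     Σ[ k ∈ ℕ ] ι b ≡ content κ + ι (suc k) → RaisesFirstRowHook b l κ →
                     RaisesFirstRowHook p (b ∷ l) (shiftDown b κ)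
  raises-shiftDown {p} {b} {l} {κ} b≤p pl pλ (k , b≡c+1+k) raises a p≤a =
    shifted (raises (suc a) (ℕ.≤-trans b≤p (ℕ.≤-trans p≤a (ℕ.n≤1+n a))))
    where
    b≤a = ℕ.≤-trans b≤p p≤a
    u = suc a ∸ b
    longRow : ∀ {ν} → IsPartition (b ∷ ν) → rowHooks (suc a) 0 ν ↭ u ∷ rowHooks a 0 (b ∷ ν)
    longRow pν = rowHooks-↭ (IsPartition-rows≤head pν) a 0 z≤n b≤a
    shifted : Σ[ d ∈ ℕ ] (ι (suc a) ≡ content κ + ι d × Raises d (rowHooks (suc a) 0 l) (rowHooks (suc a) 0 (diagram κ))) →
              Σ[ d ∈ ℕ ] (ι a ≡ (content κ - 1ℚ) + ι d × Raises d (rowHooks a 0 (b ∷ l)) (rowHooks a 0 (b ∷ diagram κ)))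
    shifted (d , 1+a≡c+d , X , l↭d∷X , λ↭1+d∷X) = d , ι-pred (content κ) a d 1+a≡c+d , Y , short↭d∷Y ,
      drop-∷ (↭-trans (↭-sym (longRow pλ)) (↭-trans λ↭1+d∷X (↭-trans (↭-prep (suc d) X↭u∷Y) (↭-swap (suc d) u ↭-refl))))
      where
      cancelled = ↭-cancel (content<⇒hook≢ a b (content κ) k d (ℕ.≤-trans b≤a (ℕ.n≤1+n a)) b≡c+1+k 1+a≡c+d)
                           (↭-trans (↭-sym (longRow pl)) l↭d∷X)
      Y = proj₁ cancelled
      short↭d∷Y = proj₁ (proj₂ cancelled)
      X↭u∷Y = proj₂ (proj₂ cancelled)

  outerCornersUnder-correct : ∀ {p l} → IsPartition (p ∷ l) → All (IsCornerUnder p l) (outerCornersUnder p l)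
  outerCornersUnder-correct {p} {[]} p≥1 = corner ∷ []
    where
    corner : IsCornerUnder p [] (1 ∷ [] , 0ℚ)
    corner = record
      { isPartition = p≥1 , s≤s z≤n
      ; size≡       = refl
      ; content<    = p ∸ 1 , trans (cong ι (sym (ℕ.m+[n∸m]≡n p≥1))) (sym (ℚ.+-identityˡ _))
      ; raises      = raises-empty p≥1
      }
  outerCornersUnder-correct {p} {b ∷ l} (b≤p , pl) =
    All.++⁺ (growRow (ℕ.<ᵇ-reflects-< b p)) (All.map⁺ (All.map shifted (outerCornersUnder-correct pl)))
    where
    growRow : ∀ {t} → Reflects (b < p) t → All (IsCornerUnder p (b ∷ l)) (if t then (suc b ∷ l , ι b) ∷ [] else [])
    growRow (ofⁿ _)   = []
    growRow (ofʸ b<p) = record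
      { isPartition = b<p , IsPartition-raiseHead pl (ℕ.n≤1+n b)
      ; size≡       = refl
      ; content<    = p ∸ suc b , trans (cong ι (sym (trans (ℕ.+-suc b (p ∸ suc b)) (ℕ.m+[n∸m]≡n b<p)))) (ι-+ b _)
      ; raises      = raises-growRow pl b<p
      } ∷ []
    shifted : ∀ {κ} → IsCornerUnder b l κ → IsCornerUnder p (b ∷ l) (shiftDown b κ)
    shifted {κ} isCorner = record
      { isPartition = b≤p , isPartition
      ; size≡       = trans (cong (b ℕ.+_) size≡) (ℕ.+-suc b (size l))
      ; content<    = suc (k ℕ.+ (p ∸ b)) ,
                      trans (cong ι (sym (ℕ.m+[n∸m]≡n b≤p))) (ι-shiftContent (content κ) b (suc k) (p ∸ b) b≡c+1+k)
      ; raises      = raises-shiftDown {κ = κ} b≤p pl isPartition content< raises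
      }
      where
      open IsCornerUnder isCorner
      k = proj₁ content<
      b≡c+1+k = proj₂ content<

  outerCorners-correct : ∀ {μ} → IsPartition μ → All (IsCorner μ) (outerCorners μ)
  outerCorners-correct {[]}    _  = record
    { isPartition = s≤s z≤n ; size≡ = refl ; content≤ = λ a _ → a , sym (ℚ.+-identityˡ _) } ∷ []
  outerCorners-correct {a ∷ l} pμ = growFirstRow ∷ All.map⁺ (All.map shifted (outerCornersUnder-correct pμ))
    where
    growFirstRow : IsCorner (a ∷ l) (suc a ∷ l , ι a)
    growFirstRow = record
      { isPartition = IsPartition-raiseHead pμ (ℕ.n≤1+n a)
      ; size≡       = refl
      ; content≤    = λ b a≤b → b ∸ a , ι-split a≤b
      }
    shifted : ∀ {κ} → IsCornerUnder a l κ → IsCorner (a ∷ l) (shiftDown a κ)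
    shifted {κ} isCorner = record
      { isPartition = isPartition
      ; size≡       = trans (cong (a ℕ.+_) size≡) (ℕ.+-suc a (size l))
      ; content≤    = λ b a≤b → suc (suc k ℕ.+ (b ∸ a)) ,
                      trans (cong ι (sym (ℕ.m+[n∸m]≡n a≤b))) (ι-shiftContent (content κ) a (suc k) (b ∸ a) a≡c+1+k)
      }
      where
      open IsCornerUnder isCorner
      k = proj₁ content<
      a≡c+1+k = proj₂ content<

  All-outerCornersUnder : ∀ {P : Corner → Set} b ν → All P (outerCorners ν) → All P (outerCornersUnder b ν)
  All-outerCornersUnder b []      ps = ps
  All-outerCornersUnder b (y ∷ r) (p ∷ ps) with y <ᵇ b
  ... | true  = p ∷ ps
  ... | false = ps

module HookStatistics where

  open import Data.Nat as ℕ using (ℕ; suc; _∸_; _≤_; z≤n; s≤s)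
  import Data.Nat.Properties as ℕ
  open import Data.Nat.ListAction using (sum; product)
  open import Data.Nat.ListAction.Properties using (product-↭)
  open import Data.Rational using (ℚ; 0ℚ; 1ℚ; _+_; _-_; _*_)
  import Data.Rational.Properties as ℚ
  open import Data.Rational.Solver using (module +-*-Solver)
  open import Data.List using (List; []; _∷_; map)
  open import Data.List.Properties using (map-∘; map-cong-local)
  open import Data.List.Relation.Unary.All as All using (All; []; _∷_)
  import Data.List.Relation.Unary.All.Properties as All
  open import Data.List.Relation.Binary.Permutation.Propositional using (_↭_)
  import Data.List.Relation.Binary.Permutation.Propositional.Properties as ↭
  open import Data.Product using (Σ-syntax; _×_; _,_)
  open import Function using (_∘_)
  open import Relation.Binary.PropositionalEquality
  open import Defs
  open RationalFacts
  open Hooks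
  open OuterCorners

  open +-*-Solver

  ι-H≢0 : ∀ {μ} → IsPartition μ → ι (H μ) ≢ 0ℚ
  ι-H≢0 pμ = ι≢0 (H-pos pμ)

  weight : List ℕ → List ℕ → ℚ
  weight μ λ′ = ι (H μ) * ι (H λ′) ⁻¹

  rowH : ℕ → List ℕ → ℕ
  rowH a l = product (rowHooks a 0 l)

  ι-rowH≢0 : ∀ a l → ι (rowH a l) ≢ 0ℚ
  ι-rowH≢0 a l = ι≢0 (product-pos (rowHooks-pos a 0 l))

  sqMinus1 : ℕ → ℚ
  sqMinus1 h = ι h * ι h - 1ℚ

  rowS : ℕ → List ℕ → ℚ
  rowS a l = sumℚ (map sqMinus1 (rowHooks a 0 l))

  ι-S1-∷ : ∀ {a l} → IsPartition (a ∷ l) → ι (S1 (a ∷ l)) ≡ rowS a l + ι (S1 l)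
  ι-S1-∷ {a} {l} pal = begin
    ι (S1 (a ∷ l))
      ≡⟨ cong ι (S1-∷ pal) ⟩
    ι (sum (map sq∸1 (rowHooks a 0 l)) ℕ.+ S1 l)
      ≡⟨ ι-+ (sum (map sq∸1 (rowHooks a 0 l))) (S1 l) ⟩
    ι (sum (map sq∸1 (rowHooks a 0 l))) + ι (S1 l)
      ≡⟨ cong (_+ ι (S1 l)) ι-rowS ⟩
    rowS a l + ι (S1 l) ∎
    where
    open ≡-Reasoning
    sq∸1 : ℕ → ℕ
    sq∸1 h = h ℕ.* h ∸ 1
    ι-sq∸1 : ∀ {h} → 1 ≤ h → ι (sq∸1 h) ≡ sqMinus1 h
    ι-sq∸1 {h} h≥1 = trans (ι-∸ (ℕ.*-mono-≤ h≥1 h≥1)) (cong (_- 1ℚ) (ι-* h h))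
    ι-rowS : ι (sum (map sq∸1 (rowHooks a 0 l))) ≡ rowS a l
    ι-rowS = trans (ι-sum (map sq∸1 (rowHooks a 0 l))) (cong sumℚ (trans (sym (map-∘ (rowHooks a 0 l)))
                                                (map-cong-local (All.map ι-sq∸1 (rowHooks-pos a 0 l)))))

  rowS-↭ : ∀ {a b ν} → b ≤ a → All (_≤ b) ν → rowS (suc a) ν ≡ sqMinus1 (suc a ∸ b) + rowS a (b ∷ ν)
  rowS-↭ {a} b≤a ν≤b = sumℚ-↭ (↭.map⁺ sqMinus1 (rowHooks-↭ ν≤b a 0 z≤n b≤a))

  rowH-↭ : ∀ {a b ν} → b ≤ a → All (_≤ b) ν → rowH (suc a) ν ≡ (suc a ∸ b) ℕ.* rowH a (b ∷ ν)
  rowH-↭ {a} b≤a ν≤b = product-↭ (rowHooks-↭ ν≤b a 0 z≤n b≤a)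

  rowS-[] : ∀ a → rowS (suc a) [] ≡ sqMinus1 (suc a) + rowS a []
  rowS-[] a = trans (cong (sumℚ ∘ map sqMinus1) (rowHooks-legless (suc a) (λ _ → refl)))
                       (cong (λ hs → sqMinus1 (suc a) + sumℚ (map sqMinus1 hs)) (sym (rowHooks-legless a (λ _ → refl))))

  rowH-[] : ∀ a → rowH (suc a) [] ≡ suc a ℕ.* rowH a []
  rowH-[] a = trans (cong product (rowHooks-legless (suc a) (λ _ → refl)))
                       (cong (λ hs → suc a ℕ.* product hs) (sym (rowHooks-legless a (λ _ → refl))))

  ΔrowS : ℕ → List ℕ → ℚ
  ΔrowS a ν = ι a * ι a + ι 2 * (ι a + ι (size ν))

  rowS-suc : ∀ ν {a} → IsPartition (a ∷ ν) → rowS (suc a) ν ≡ rowS a ν + ΔrowS a ν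
  rowS-suc [] {a} _ = begin
    rowS (suc a) []
      ≡⟨ rowS-[] a ⟩
    sqMinus1 (suc a) + rowS a []
      ≡⟨ cong (λ x → (x * x - 1ℚ) + rowS a []) (ι-suc a) ⟩
    ((1ℚ + ι a) * (1ℚ + ι a) - 1ℚ) + rowS a []
      ≡⟨ solve 2 (λ x s → ((con 1ℚ :+ x) :* (con 1ℚ :+ x) :- con 1ℚ) :+ s
         := s :+ (x :* x :+ con (ι 2) :* (x :+ con 0ℚ))) refl (ι a) (rowS a []) ⟩
    rowS a [] + ΔrowS a [] ∎
    where open ≡-Reasoning
  rowS-suc (b ∷ ν) {a} (b≤a , pbν) = begin
    rowS (suc a) (b ∷ ν)
      ≡⟨ solve 2 (λ x s → x := (s :+ x) :- s) refl (rowS (suc a) (b ∷ ν)) (sqMinus1 (suc u)) ⟩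
    (sqMinus1 (suc u) + rowS (suc a) (b ∷ ν)) - sqMinus1 (suc u)
      ≡⟨ cong (_- sqMinus1 (suc u)) shuffle ⟩
    ((sqMinus1 u + rowS a (b ∷ ν)) + ΔrowS (suc a) ν) - sqMinus1 (suc u)
      ≡⟨ solve 4 (λ s t y k → ((s :+ y) :+ k) :- t := y :+ ((s :- t) :+ k))
               refl (sqMinus1 u) (sqMinus1 (suc u)) (rowS a (b ∷ ν)) (ΔrowS (suc a) ν) ⟩
    rowS a (b ∷ ν) + ((sqMinus1 u - sqMinus1 (suc u)) + ΔrowS (suc a) ν)
      ≡⟨ cong (rowS a (b ∷ ν) +_) increment ⟩
    rowS a (b ∷ ν) + ΔrowS a (b ∷ ν) ∎
    where
    open ≡-Reasoning
    ν≤b = IsPartition-rows≤head pbν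
    b≤1+a = ℕ.≤-trans b≤a (ℕ.n≤1+n a)
    u = suc a ∸ b
    shuffle : sqMinus1 (suc u) + rowS (suc a) (b ∷ ν) ≡ (sqMinus1 u + rowS a (b ∷ ν)) + ΔrowS (suc a) ν
    shuffle = begin
      sqMinus1 (suc u) + rowS (suc a) (b ∷ ν)
        ≡⟨ cong (λ h → sqMinus1 h + rowS (suc a) (b ∷ ν)) (ℕ.+-∸-assoc 1 b≤1+a) ⟨
      sqMinus1 (suc (suc a) ∸ b) + rowS (suc a) (b ∷ ν)
        ≡⟨ rowS-↭ b≤1+a ν≤b ⟨
      rowS (suc (suc a)) ν
        ≡⟨ rowS-suc ν (IsPartition-raiseHead pbν b≤1+a) ⟩
      rowS (suc a) ν + ΔrowS (suc a) ν
        ≡⟨ cong (_+ ΔrowS (suc a) ν) (rowS-↭ b≤a ν≤b) ⟩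
      (sqMinus1 u + rowS a (b ∷ ν)) + ΔrowS (suc a) ν ∎
    increment : (sqMinus1 u - sqMinus1 (suc u)) + ΔrowS (suc a) ν ≡ ΔrowS a (b ∷ ν)
    increment = begin
      (sqMinus1 u - sqMinus1 (suc u)) + ΔrowS (suc a) ν
        ≡⟨ cong₃ (λ x y z → (x * x - 1ℚ - (y * y - 1ℚ)) + (z * z + ι 2 * (z + ι (size ν))))
                 ι-u (trans (ι-suc u) (cong (1ℚ +_) ι-u)) (ι-suc a) ⟩
      (t * t - 1ℚ - ((1ℚ + t) * (1ℚ + t) - 1ℚ)) + ((1ℚ + ι a) * (1ℚ + ι a) + ι 2 * ((1ℚ + ι a) + ι (size ν)))
        ≡⟨ solve 3 (λ a b n → let t = con 1ℚ :+ a :- b in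
                      (t :* t :- con 1ℚ :- ((con 1ℚ :+ t) :* (con 1ℚ :+ t) :- con 1ℚ))
                      :+ ((con 1ℚ :+ a) :* (con 1ℚ :+ a) :+ con (ι 2) :* ((con 1ℚ :+ a) :+ n))
                    := a :* a :+ con (ι 2) :* (a :+ (b :+ n)))
                 refl (ι a) (ι b) (ι (size ν)) ⟩
      ι a * ι a + ι 2 * (ι a + (ι b + ι (size ν)))
        ≡⟨ cong (λ x → ι a * ι a + ι 2 * (ι a + x)) (ι-+ b (size ν)) ⟨
      ΔrowS a (b ∷ ν) ∎
      where
      t = 1ℚ + ι a - ι b
      ι-u : ι u ≡ t
      ι-u = trans (ι-∸ b≤1+a) (cong (_- ι b) (ι-suc a))

  S1-increment : List ℕ → Corner → Set
  S1-increment μ κ = ι (S1 (diagram κ)) ≡ ι (S1 μ) + (content κ * content κ + ι 2 * ι (size μ))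

  S1-increment-growFirstRow : ∀ {b ν} → IsPartition (b ∷ ν) → S1-increment (b ∷ ν) (suc b ∷ ν , ι b)
  S1-increment-growFirstRow {b} {ν} pbν = begin
    ι (S1 (suc b ∷ ν))
      ≡⟨ ι-S1-∷ (IsPartition-raiseHead pbν (ℕ.n≤1+n b)) ⟩
    rowS (suc b) ν + ι (S1 ν)
      ≡⟨ cong (_+ ι (S1 ν)) (rowS-suc ν pbν) ⟩
    (rowS b ν + ΔrowS b ν) + ι (S1 ν)
      ≡⟨ solve 4 (λ s t x n → (s :+ (x :* x :+ con (ι 2) :* (x :+ n))) :+ t
         := (s :+ t) :+ (x :* x :+ con (ι 2) :* (x :+ n))) refl (rowS b ν) (ι (S1 ν)) (ι b) (ι (size ν)) ⟩
    (rowS b ν + ι (S1 ν)) + (ι b * ι b + ι 2 * (ι b + ι (size ν)))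
      ≡⟨ cong₂ (λ x y → x + (ι b * ι b + ι 2 * y)) (ι-S1-∷ pbν) (ι-+ b (size ν)) ⟨
    ι (S1 (b ∷ ν)) + (ι b * ι b + ι 2 * ι (size (b ∷ ν))) ∎
    where open ≡-Reasoning

  S1-increment-shiftDown : ∀ {b ν κ} → IsPartition (b ∷ ν) → IsCornerUnder b ν κ →
                           S1-increment ν κ → S1-increment (b ∷ ν) (shiftDown b κ)
  S1-increment-shiftDown {b} {ν} {κ} pbν isCorner S1-inc = shifted (IsCornerUnder.raises isCorner b ℕ.≤-refl)
    where
    open ≡-Reasoning
    λ′ = diagram κ
    c = content κ
    shifted : Σ[ d ∈ ℕ ] (ι b ≡ c + ι d × Raises d (rowHooks b 0 ν) (rowHooks b 0 λ′)) → S1-increment (b ∷ ν) (shiftDown b κ)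
    shifted (d , b≡c+d , X , ν↭d∷X , λ↭1+d∷X) = begin
      ι (S1 (b ∷ λ′))
        ≡⟨ ι-S1-∷ (IsCornerUnder.isPartition isCorner) ⟩
      rowS b λ′ + ι (S1 λ′)
        ≡⟨ cong₂ _+_ (sumℚ-↭ (↭.map⁺ sqMinus1 λ↭1+d∷X)) S1-inc ⟩
      (sqMinus1 (suc d) + ΣX) + (ι (S1 ν) + (c * c + ι 2 * ι (size ν)))
        ≡⟨ cong (λ x → ((x * x - 1ℚ) + ΣX) + (ι (S1 ν) + (c * c + ι 2 * ι (size ν)))) (ι-suc d) ⟩
      (((1ℚ + ι d) * (1ℚ + ι d) - 1ℚ) + ΣX) + (ι (S1 ν) + (c * c + ι 2 * ι (size ν)))
        ≡⟨ solve 5 (λ x s t c n → (((con 1ℚ :+ x) :* (con 1ℚ :+ x) :- con 1ℚ) :+ s) :+ (t :+ (c :* c :+ con (ι 2) :* n))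
           := ((x :* x :- con 1ℚ :+ s) :+ t) :+ ((c :- con 1ℚ) :* (c :- con 1ℚ) :+ con (ι 2) :* ((c :+ x) :+ n)))
           refl (ι d) ΣX (ι (S1 ν)) c (ι (size ν)) ⟩
      ((sqMinus1 d + ΣX) + ι (S1 ν)) + ((c - 1ℚ) * (c - 1ℚ) + ι 2 * ((c + ι d) + ι (size ν)))
        ≡⟨ cong₂ (λ x y → (x + ι (S1 ν)) + ((c - 1ℚ) * (c - 1ℚ) + ι 2 * y))
           (sumℚ-↭ (↭.map⁺ sqMinus1 ν↭d∷X)) (trans (ι-+ b (size ν)) (cong (_+ ι (size ν)) b≡c+d)) ⟨
      (rowS b ν + ι (S1 ν)) + ((c - 1ℚ) * (c - 1ℚ) + ι 2 * ι (size (b ∷ ν)))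
        ≡⟨ cong (_+ ((c - 1ℚ) * (c - 1ℚ) + ι 2 * ι (size (b ∷ ν)))) (ι-S1-∷ pbν) ⟨
      ι (S1 (b ∷ ν)) + ((c - 1ℚ) * (c - 1ℚ) + ι 2 * ι (size (b ∷ ν))) ∎
      where
      ΣX = sumℚ (map sqMinus1 X)

  S1-increments : ∀ {μ} → IsPartition μ → All (S1-increment μ) (outerCorners μ)
  S1-increments {[]}    _   = refl ∷ []
  S1-increments {b ∷ ν} pbν = S1-increment-growFirstRow pbν ∷ All.map⁺ (All.zipWith (λ (isCorner , S1-inc) →
    S1-increment-shiftDown pbν isCorner S1-inc) (outerCornersUnder-correct pbν ,
    All-outerCornersUnder b ν (S1-increments (IsPartition-tail pbν))))

  rowRatio : ℕ → List ℕ → ℚ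
  rowRatio a l = ι (rowH a l) * ι (rowH (suc a) l) ⁻¹

  weight-growFirstRow : ∀ {b ν} → IsPartition (b ∷ ν) → weight (b ∷ ν) (suc b ∷ ν) ≡ rowRatio b ν
  weight-growFirstRow {b} {ν} pbν = begin
    ι (H (b ∷ ν)) * ι (H (suc b ∷ ν)) ⁻¹
      ≡⟨ cong₂ (λ x y → ι x * ι y ⁻¹) (H-∷ pbν) (H-∷ (IsPartition-raiseHead pbν (ℕ.n≤1+n b))) ⟩
    ι (rowH b ν ℕ.* H ν) * ι (rowH (suc b) ν ℕ.* H ν) ⁻¹
      ≡⟨ cong₂ (λ x y → x * y ⁻¹) (ι-* (rowH b ν) (H ν)) (ι-* (rowH (suc b) ν) (H ν)) ⟩
    (ι (rowH b ν) * ι (H ν)) * (ι (rowH (suc b) ν) * ι (H ν)) ⁻¹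
      ≡⟨ *-⁻¹-cancelʳ (ι (rowH b ν)) (ι-rowH≢0 (suc b) ν) (ι-H≢0 (IsPartition-tail pbν)) ⟩
    rowRatio b ν ∎
    where open ≡-Reasoning

  ι-H-split : ∀ {a l h X} → IsPartition (a ∷ l) → rowHooks a 0 l ↭ h ∷ X →
              ι (H (a ∷ l)) ≡ (ι h * ι (H l)) * ι (product X)
  ι-H-split {a} {l} {h} {X} pal hooks↭ = begin
    ι (H (a ∷ l))
      ≡⟨ cong ι (trans (H-∷ pal) (cong (ℕ._* H l) (product-↭ hooks↭))) ⟩
    ι ((h ℕ.* product X) ℕ.* H l)
      ≡⟨ trans (ι-* (h ℕ.* product X) (H l)) (cong (_* ι (H l)) (ι-* h (product X))) ⟩
    (ι h * ι (product X)) * ι (H l)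
      ≡⟨ solve 3 (λ x y z → (x :* y) :* z := (x :* z) :* y) refl (ι h) (ι (product X)) (ι (H l)) ⟩
    (ι h * ι (H l)) * ι (product X) ∎
    where open ≡-Reasoning

  weight-shiftDown : ∀ {b ν κ} → IsPartition (b ∷ ν) → IsCornerUnder b ν κ →
                     weight (b ∷ ν) (b ∷ diagram κ) ≡ weight ν (diagram κ) * (1ℚ - (ι b + 1ℚ - content κ) ⁻¹)
  weight-shiftDown {b} {ν} {κ} pbν isCorner = shifted (IsCornerUnder.raises isCorner b ℕ.≤-refl)
    where
    open ≡-Reasoning
    λ′ = diagram κ
    c = content κ
    pbλ = IsCornerUnder.isPartition isCorner
    Hλ≢0 = ι-H≢0 (IsPartition-tail pbλ)
    shifted : Σ[ d ∈ ℕ ] (ι b ≡ c + ι d × Raises d (rowHooks b 0 ν) (rowHooks b 0 λ′)) →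
              weight (b ∷ ν) (b ∷ λ′) ≡ weight ν λ′ * (1ℚ - (ι b + 1ℚ - c) ⁻¹)
    shifted (d , b≡c+d , X , ν↭d∷X , λ↭1+d∷X) = begin
      ι (H (b ∷ ν)) * ι (H (b ∷ λ′)) ⁻¹
        ≡⟨ cong₂ (λ x y → x * y ⁻¹) (ι-H-split pbν ν↭d∷X) (ι-H-split pbλ λ↭1+d∷X) ⟩
      ((ι d * ι (H ν)) * ι (product X)) * ((ι (suc d) * ι (H λ′)) * ι (product X)) ⁻¹
        ≡⟨ *-⁻¹-cancelʳ (ι d * ι (H ν)) (*-≢0 (ι[1+n]≢0 d) Hλ≢0) ΠX≢0 ⟩
      (ι d * ι (H ν)) * (ι (suc d) * ι (H λ′)) ⁻¹
        ≡⟨ cong ((ι d * ι (H ν)) *_) (⁻¹-distrib-* (ι[1+n]≢0 d) Hλ≢0) ⟩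
      (ι d * ι (H ν)) * (ι (suc d) ⁻¹ * ι (H λ′) ⁻¹)
        ≡⟨ solve 4 (λ a b c e → (a :* b) :* (c :* e) := (b :* e) :* (a :* c)) refl (ι d) (ι (H ν)) (ι (suc d) ⁻¹) (ι (H λ′) ⁻¹) ⟩
      weight ν λ′ * (ι d * ι (suc d) ⁻¹)
        ≡⟨ cong (weight ν λ′ *_) (trans (sym (1-ι[1+n]⁻¹ d)) (cong (λ x → 1ℚ - x ⁻¹) 1+d≡b+1-c)) ⟩
      weight ν λ′ * (1ℚ - (ι b + 1ℚ - c) ⁻¹) ∎
      where
      ΠX≢0 : ι (product X) ≢ 0ℚ
      ΠX≢0 = ι≢0 (product-pos (All.tail (↭.All-resp-↭ λ↭1+d∷X (rowHooks-pos b 0 λ′))))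
      1+d≡b+1-c : ι (suc d) ≡ ι b + 1ℚ - c
      1+d≡b+1-c = trans (ι-suc d) (trans (solve 2 (λ x c → con 1ℚ :+ x := (c :+ x) :+ con 1ℚ :- c) refl (ι d) c)
                                         (cong (λ x → x + 1ℚ - c) (sym b≡c+d)))

  rowRatio-∷ : ∀ {a b ν} → b ≤ a → IsPartition (b ∷ ν) →
               (1ℚ + (ι a + 1ℚ - ι b) ⁻¹) * rowRatio (suc a) ν ≡ rowRatio a (b ∷ ν)
  rowRatio-∷ {a} {b} {ν} b≤a pbν = begin
    (1ℚ + (ι a + 1ℚ - ι b) ⁻¹) * rowRatio (suc a) ν
      ≡⟨ cong₂ (λ x y → (1ℚ + x ⁻¹) * y) a+1-b≡m rowRatio-suc ⟩
    (1ℚ + M ⁻¹) * ((M * ι Ga) * (ι (suc m) ⁻¹ * ι Gs ⁻¹))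
      ≡⟨ solve 5 (λ k M g i j → (con 1ℚ :+ k) :* ((M :* g) :* (i :* j)) := ((M :+ M :* k) :* i) :* (g :* j))
         refl (M ⁻¹) M (ι Ga) (ι (suc m) ⁻¹) (ι Gs ⁻¹) ⟩
    ((M + M * M ⁻¹) * ι (suc m) ⁻¹) * rowRatio a (b ∷ ν)
      ≡⟨ cong (λ x → ((M + x) * ι (suc m) ⁻¹) * rowRatio a (b ∷ ν)) (⁻¹-inverseʳ (ι≢0 m≥1)) ⟩
    ((M + 1ℚ) * ι (suc m) ⁻¹) * rowRatio a (b ∷ ν)
      ≡⟨ cong (λ x → (x * ι (suc m) ⁻¹) * rowRatio a (b ∷ ν)) (trans (ℚ.+-comm M 1ℚ) (sym (ι-suc m))) ⟩
    (ι (suc m) * ι (suc m) ⁻¹) * rowRatio a (b ∷ ν)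
      ≡⟨ trans (cong (_* rowRatio a (b ∷ ν)) (⁻¹-inverseʳ (ι[1+n]≢0 m))) (ℚ.*-identityˡ _) ⟩
    rowRatio a (b ∷ ν) ∎
    where
    open ≡-Reasoning
    ν≤b = IsPartition-rows≤head pbν
    b≤1+a = ℕ.≤-trans b≤a (ℕ.n≤1+n a)
    m = suc a ∸ b
    M = ι m
    Ga = rowH a (b ∷ ν)
    Gs = rowH (suc a) (b ∷ ν)
    m≥1 : 1 ≤ m
    m≥1 = subst (1 ≤_) (sym (ℕ.+-∸-assoc 1 b≤a)) (s≤s z≤n)
    a+1-b≡m : ι a + 1ℚ - ι b ≡ M
    a+1-b≡m = trans (cong (_- ι b) (trans (ℚ.+-comm (ι a) 1ℚ) (sym (ι-suc a)))) (sym (ι-∸ b≤1+a))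
    rowRatio-suc : rowRatio (suc a) ν ≡ (M * ι Ga) * (ι (suc m) ⁻¹ * ι Gs ⁻¹)
    rowRatio-suc = begin
      ι (rowH (suc a) ν) * ι (rowH (suc (suc a)) ν) ⁻¹
        ≡⟨ cong₂ (λ x y → ι x * ι y ⁻¹) (rowH-↭ b≤a ν≤b)
           (trans (rowH-↭ b≤1+a ν≤b) (cong (ℕ._* Gs) (ℕ.+-∸-assoc 1 b≤1+a))) ⟩
      ι (m ℕ.* Ga) * ι (suc m ℕ.* Gs) ⁻¹
        ≡⟨ cong₂ (λ x y → x * y ⁻¹) (ι-* m Ga) (ι-* (suc m) Gs) ⟩
      (M * ι Ga) * (ι (suc m) * ι Gs) ⁻¹
        ≡⟨ cong ((M * ι Ga) *_) (⁻¹-distrib-* (ι[1+n]≢0 m) (ι-rowH≢0 (suc a) (b ∷ ν))) ⟩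
      (M * ι Ga) * (ι (suc m) ⁻¹ * ι Gs ⁻¹) ∎

module TransitionMeasure where

  open import Data.Nat as ℕ using (ℕ; suc; _∸_; _≤_; _<_)
  import Data.Nat.Properties as ℕ
  open import Data.Rational using (ℚ; 0ℚ; 1ℚ; _+_; _-_; _*_; -_)
  import Data.Rational.Properties as ℚ
  open import Data.Rational.Solver using (module +-*-Solver)
  open import Data.Bool using (if_then_else_)
  open import Data.List using (List; []; _∷_; map; _++_)
  open import Data.List.Properties using (map-∘; map-cong; map-cong-local)
  open import Data.List.Relation.Unary.All as All using (All; []; _∷_)
  import Data.List.Relation.Unary.All.Properties as All
  open import Data.Product using (_,_; proj₁; proj₂)
  open import Function using (_∘_)
  open import Relation.Nullary.Reflects using (Reflects; ofʸ; ofⁿ)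
  open import Relation.Binary.PropositionalEquality
  open import Defs
  open RationalFacts
  open Hooks
  open OuterCorners

  open HookStatistics

  open +-*-Solver

  -- The integral of g against Kerov's transition measure of μ, which has mass H_μ / H_{μ+□} at the
  -- content of each outer corner □.
  𝔼 : List ℕ → (ℚ → ℚ) → ℚ
  𝔼 μ g = sumℚ (map (λ κ → weight μ (diagram κ) * g (content κ)) (outerCorners μ))

  𝔼-cong-local : ∀ μ {f g : ℚ → ℚ} → All (λ κ → f (content κ) ≡ g (content κ)) (outerCorners μ) → 𝔼 μ f ≡ 𝔼 μ g
  𝔼-cong-local μ f≡g = cong sumℚ (map-cong-local (All.map (λ {κ} → cong (weight μ (diagram κ) *_)) f≡g))

  𝔼-cong : ∀ μ {f g : ℚ → ℚ} → (∀ c → f c ≡ g c) → 𝔼 μ f ≡ 𝔼 μ g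
  𝔼-cong μ f≡g = 𝔼-cong-local μ (All.tabulate (λ {κ} _ → f≡g (content κ)))

  𝔼-+ : ∀ μ (f g : ℚ → ℚ) → 𝔼 μ (λ c → f c + g c) ≡ 𝔼 μ f + 𝔼 μ g
  𝔼-+ μ f g = trans (cong sumℚ (map-cong (λ κ → ℚ.*-distribˡ-+ (weight μ (diagram κ)) _ _) (outerCorners μ)))
                    (sumℚ-map-+ _ _ (outerCorners μ))

  𝔼-*ˡ : ∀ μ k (f : ℚ → ℚ) → 𝔼 μ (λ c → k * f c) ≡ k * 𝔼 μ f
  𝔼-*ˡ μ k f = trans (cong sumℚ (map-cong (λ κ → solve 3 (λ w k f → w :* (k :* f) := k :* (w :* f)) refl
                                                      (weight μ (diagram κ)) k (f (content κ))) (outerCorners μ)))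
                     (sumℚ-map-*ˡ k _ (outerCorners μ))

  sumℚ-outerCornersUnder : ∀ (F : Corner → ℚ) {b} ν → IsPartition (b ∷ ν) → (∀ r → F (suc b ∷ r , ι b) ≡ 0ℚ) →
                           sumℚ (map F (outerCornersUnder b ν)) ≡ sumℚ (map F (outerCorners ν))
  sumℚ-outerCornersUnder F []      _         _       = refl
  sumℚ-outerCornersUnder F {b} (y ∷ r) (y≤b , _) F-blocked = byCases (ℕ.<ᵇ-reflects-< y b)
    where
    rest = map (shiftDown y) (outerCornersUnder y r)
    byCases : ∀ {t} → Reflects (y < b) t →
              sumℚ (map F ((if t then (suc y ∷ r , ι y) ∷ [] else []) ++ rest)) ≡ sumℚ (map F ((suc y ∷ r , ι y) ∷ rest))
    byCases (ofʸ _)   = refl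
    byCases (ofⁿ y≮b) = trans (sym (ℚ.+-identityˡ _))
      (cong (_+ sumℚ (map F rest)) (sym (trans (cong (λ x → F (suc x ∷ r , ι x)) (ℕ.≤∧≮⇒≡ y≤b y≮b)) (F-blocked r))))

  𝔼-∷ : ∀ {b ν} → IsPartition (b ∷ ν) → ∀ g →
        𝔼 (b ∷ ν) g ≡ rowRatio b ν * g (ι b) + 𝔼 ν (λ c → (1ℚ - (ι b + 1ℚ - c) ⁻¹) * g (c - 1ℚ))
  𝔼-∷ {b} {ν} pbν g = cong₂ _+_ (cong (_* g (ι b)) (weight-growFirstRow pbν)) (begin
    sumℚ (map F (map (shiftDown b) (outerCornersUnder b ν)))
      ≡⟨ cong sumℚ (map-∘ (outerCornersUnder b ν)) ⟨
    sumℚ (map (F ∘ shiftDown b) (outerCornersUnder b ν))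
      ≡⟨ cong sumℚ (map-cong-local (All.map shifted (outerCornersUnder-correct pbν))) ⟩
    sumℚ (map F′ (outerCornersUnder b ν))
      ≡⟨ sumℚ-outerCornersUnder F′ ν pbν F′-blocked ⟩
    sumℚ (map F′ (outerCorners ν)) ∎)
    where
    open ≡-Reasoning
    F : Corner → ℚ
    F κ = weight (b ∷ ν) (diagram κ) * g (content κ)
    F′ : Corner → ℚ
    F′ κ = weight ν (diagram κ) * ((1ℚ - (ι b + 1ℚ - content κ) ⁻¹) * g (content κ - 1ℚ))
    shifted : ∀ {κ} → IsCornerUnder b ν κ → F (shiftDown b κ) ≡ F′ κ
    shifted {κ} isCorner = trans (cong (_* g (content κ - 1ℚ)) (weight-shiftDown pbν isCorner))
                                  (ℚ.*-assoc (weight ν (diagram κ)) (1ℚ - (ι b + 1ℚ - content κ) ⁻¹) (g (content κ - 1ℚ)))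
    F′-blocked : ∀ r → F′ (suc b ∷ r , ι b) ≡ 0ℚ
    F′-blocked r = begin
      weight ν (suc b ∷ r) * ((1ℚ - (ι b + 1ℚ - ι b) ⁻¹) * g (ι b - 1ℚ))
        ≡⟨ cong (λ x → weight ν (suc b ∷ r) * ((1ℚ - x ⁻¹) * g (ι b - 1ℚ))) (solve 1 (λ x → x :+ con 1ℚ :- x := con 1ℚ) refl (ι b)) ⟩
      weight ν (suc b ∷ r) * ((1ℚ - 1ℚ ⁻¹) * g (ι b - 1ℚ))
        ≡⟨ solve 2 (λ w y → w :* ((con 1ℚ :- con 1ℚ) :* y) := con 0ℚ) refl (weight ν (suc b ∷ r)) (g (ι b - 1ℚ)) ⟩
      0ℚ ∎

  -- The reweighting factor of 𝔼-∷ times g (c − 1), brought into the shape used by 𝔼-combination.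
  reweight-const : ∀ B c → (1ℚ - (B + 1ℚ - c) ⁻¹) * 1ℚ ≡ 0ℚ * (c * c) + 0ℚ * c + 1ℚ + (- 1ℚ) * (B + 1ℚ - c) ⁻¹
  reweight-const B c = solve 2 (λ c v → (con 1ℚ :- v) :* con 1ℚ := con 0ℚ :* (c :* c) :+ con 0ℚ :* c :+ con 1ℚ :+ (:- con 1ℚ) :* v)
                               refl c ((B + 1ℚ - c) ⁻¹)

  module _ (B c : ℚ) (u≢0 : B + 1ℚ - c ≢ 0ℚ) where

    private
      v = (B + 1ℚ - c) ⁻¹

    reweight-linear : (1ℚ - v) * (c - 1ℚ) ≡ 0ℚ * (c * c) + 1ℚ * c + 0ℚ + (- B) * v
    reweight-linear = begin
      (1ℚ - v) * (c - 1ℚ)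
        ≡⟨ solve 3 (λ B c v → (con 1ℚ :- v) :* (c :- con 1ℚ)
           := (c :- B :* v) :+ ((B :+ con 1ℚ :- c) :* v :- con 1ℚ)) refl B c v ⟩
      (c - B * v) + ((B + 1ℚ - c) * v - 1ℚ)
        ≡⟨ cong (λ x → (c - B * v) + (x - 1ℚ)) (⁻¹-inverseʳ u≢0) ⟩
      (c - B * v) + (1ℚ - 1ℚ)
        ≡⟨ solve 3 (λ B c v → (c :- B :* v) :+ (con 1ℚ :- con 1ℚ)
           := con 0ℚ :* (c :* c) :+ con 1ℚ :* c :+ con 0ℚ :+ (:- B) :* v) refl B c v ⟩
      0ℚ * (c * c) + 1ℚ * c + 0ℚ + (- B) * v ∎
      where open ≡-Reasoning

    reweight-square : (1ℚ - v) * ((c - 1ℚ) * (c - 1ℚ)) ≡ 1ℚ * (c * c) + (- 1ℚ) * c + B + (- (B * B)) * v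
    reweight-square = begin
      (1ℚ - v) * ((c - 1ℚ) * (c - 1ℚ))
        ≡⟨ solve 3 (λ B c v → (con 1ℚ :- v) :* ((c :- con 1ℚ) :* (c :- con 1ℚ))
           := (c :* c :- c :+ B :- B :* B :* v) :+ ((B :+ con 1ℚ :- c) :* v :- con 1ℚ) :* (B :+ c :- con 1ℚ)) refl B c v ⟩
      (c * c - c + B - B * B * v) + ((B + 1ℚ - c) * v - 1ℚ) * (B + c - 1ℚ)
        ≡⟨ cong (λ x → (c * c - c + B - B * B * v) + (x - 1ℚ) * (B + c - 1ℚ)) (⁻¹-inverseʳ u≢0) ⟩
      (c * c - c + B - B * B * v) + (1ℚ - 1ℚ) * (B + c - 1ℚ)
        ≡⟨ solve 3 (λ B c v → (c :* c :- c :+ B :- B :* B :* v) :+ (con 1ℚ :- con 1ℚ) :* (B :+ c :- con 1ℚ)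
           := con 1ℚ :* (c :* c) :+ (:- con 1ℚ) :* c :+ B :+ (:- (B :* B)) :* v) refl B c v ⟩
      1ℚ * (c * c) + (- 1ℚ) * c + B + (- (B * B)) * v ∎
      where open ≡-Reasoning

    reweight-cauchy : ∀ A → A + 1ℚ - (c - 1ℚ) ≢ 0ℚ → A + 1ℚ - B ≢ 0ℚ →
                      (1ℚ - v) * (A + 1ℚ - (c - 1ℚ)) ⁻¹
                        ≡ (1ℚ + (A + 1ℚ - B) ⁻¹) * (A + 1ℚ - (c - 1ℚ)) ⁻¹ + (- (A + 1ℚ - B) ⁻¹) * v
    reweight-cauchy A uA≢0 m≢0 = begin
      (1ℚ - v) * vA
        ≡⟨ solve 6 (λ A B c vA v k → (con 1ℚ :- v) :* vA
           := vA :- k :* ((A :+ con 1ℚ :- (c :- con 1ℚ)) :* vA :* v :- (B :+ con 1ℚ :- c) :* v :* vA)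
           :- v :* vA :* (con 1ℚ :- (A :+ con 1ℚ :- B) :* k)) refl A B c vA v k ⟩
      vA - k * (uA * vA * v - (B + 1ℚ - c) * v * vA) - v * vA * (1ℚ - m * k)
        ≡⟨ cong₃ (λ x y z → vA - k * (x * v - y * vA) - v * vA * (1ℚ - z))
           (⁻¹-inverseʳ uA≢0) (⁻¹-inverseʳ u≢0) (⁻¹-inverseʳ m≢0) ⟩
      vA - k * (1ℚ * v - 1ℚ * vA) - v * vA * (1ℚ - 1ℚ)
        ≡⟨ solve 3 (λ vA v k → vA :- k :* (con 1ℚ :* v :- con 1ℚ :* vA) :- v :* vA :* (con 1ℚ :- con 1ℚ)
           := (con 1ℚ :+ k) :* vA :+ (:- k) :* v) refl vA v k ⟩
      (1ℚ + k) * vA + (- k) * v ∎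
      where
      open ≡-Reasoning
      uA = A + 1ℚ - (c - 1ℚ)
      vA = uA ⁻¹
      m  = A + 1ℚ - B
      k  = m ⁻¹

  -- The Cauchy transform is carried along because 𝔼-∷ introduces the factor 1 / (b + 1 − c).
  record Moments (μ : List ℕ) : Set where
    field
      mass         : 𝔼 μ (λ _ → 1ℚ) ≡ 1ℚ
      mean         : 𝔼 μ (λ c → c) ≡ 0ℚ
      secondMoment : 𝔼 μ (λ c → c * c) ≡ ι (size μ)
      cauchy       : ∀ a → row μ 0 ≤ a → 𝔼 μ (λ c → (ι a + 1ℚ - c) ⁻¹) ≡ rowRatio a μ

  𝔼-const : ∀ {μ} → Moments μ → ∀ K → 𝔼 μ (λ _ → K) ≡ K
  𝔼-const {μ} moments K = begin
    𝔼 μ (λ _ → K)          ≡⟨ 𝔼-cong μ (λ _ → sym (ℚ.*-identityʳ K)) ⟩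
    𝔼 μ (λ _ → K * 1ℚ)     ≡⟨ 𝔼-*ˡ μ K (λ _ → 1ℚ) ⟩
    K * 𝔼 μ (λ _ → 1ℚ)     ≡⟨ cong (K *_) (Moments.mass moments) ⟩
    K * 1ℚ                 ≡⟨ ℚ.*-identityʳ K ⟩
    K                      ∎
    where open ≡-Reasoning

  𝔼-combination : ∀ {μ} → Moments μ → ∀ α β γ δ (h : ℚ → ℚ) →
                  𝔼 μ (λ c → α * (c * c) + β * c + γ + δ * h c) ≡ α * ι (size μ) + γ + δ * 𝔼 μ h
  𝔼-combination {μ} moments α β γ δ h = begin
    𝔼 μ (λ c → α * (c * c) + β * c + γ + δ * h c)
      ≡⟨ trans (𝔼-+ μ _ _) (cong₂ _+_ (trans (𝔼-+ μ _ _) (cong₂ _+_ (𝔼-+ μ _ _) refl)) refl) ⟩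
    (𝔼 μ (λ c → α * (c * c)) + 𝔼 μ (λ c → β * c)) + 𝔼 μ (λ _ → γ) + 𝔼 μ (λ c → δ * h c)
      ≡⟨ cong₂ _+_ (cong₂ _+_ (cong₂ _+_ (𝔼-*ˡ μ α _) (𝔼-*ˡ μ β _)) (𝔼-const moments γ)) (𝔼-*ˡ μ δ h) ⟩
    (α * 𝔼 μ (λ c → c * c) + β * 𝔼 μ (λ c → c)) + γ + δ * 𝔼 μ h
      ≡⟨ cong₂ (λ x y → (α * x + β * y) + γ + δ * 𝔼 μ h) (Moments.secondMoment moments) (Moments.mean moments) ⟩
    (α * ι (size μ) + β * 0ℚ) + γ + δ * 𝔼 μ h
      ≡⟨ solve 6 (λ a b g d e n → (a :* n :+ b :* con 0ℚ) :+ g :+ d :* e := a :* n :+ g :+ d :* e) refl α β γ δ (𝔼 μ h) (ι (size μ)) ⟩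
    α * ι (size μ) + γ + δ * 𝔼 μ h ∎
    where open ≡-Reasoning

  corner-gap : ∀ a c d → ι a ≡ c + ι d → ι a + 1ℚ - c ≢ 0ℚ
  corner-gap a c d a≡c+d gap≡0 = ι[1+n]≢0 d (begin
    ι (suc d)
      ≡⟨ ι-suc d ⟩
    1ℚ + ι d
      ≡⟨ solve 2 (λ x c → con 1ℚ :+ x := (c :+ x) :+ con 1ℚ :- c) refl (ι d) c ⟩
    (c + ι d) + 1ℚ - c
      ≡⟨ cong (λ x → x + 1ℚ - c) a≡c+d ⟨
    ι a + 1ℚ - c
      ≡⟨ gap≡0 ⟩
    0ℚ ∎)
    where open ≡-Reasoning

  IsCorner-gap : ∀ {μ κ} → IsCorner μ κ → ∀ a → row μ 0 ≤ a → ι a + 1ℚ - content κ ≢ 0ℚ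
  IsCorner-gap {κ = κ} isCorner a μ≤a = corner-gap a (content κ) (proj₁ a≡c+d) (proj₂ a≡c+d)
    where a≡c+d = IsCorner.content≤ isCorner a μ≤a

  moments-[] : Moments []
  moments-[] = record { mass = refl ; mean = refl ; secondMoment = refl ; cauchy = cauchy }
    where
    cauchy : ∀ a → 0 ≤ a → 𝔼 [] (λ c → (ι a + 1ℚ - c) ⁻¹) ≡ rowRatio a []
    cauchy a _ = begin
      1ℚ * (ι a + 1ℚ - 0ℚ) ⁻¹ + 0ℚ
        ≡⟨ cong (λ x → 1ℚ * x ⁻¹ + 0ℚ) a+1≡1+a ⟩
      1ℚ * ι (suc a) ⁻¹ + 0ℚ
        ≡⟨ ℚ.+-identityʳ _ ⟩
      1ℚ * ι (suc a) ⁻¹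
        ≡⟨ *-⁻¹-cancelʳ 1ℚ (ι[1+n]≢0 a) (ι-rowH≢0 a []) ⟨
      (1ℚ * ι G) * (ι (suc a) * ι G) ⁻¹
        ≡⟨ cong₂ (λ x y → x * y ⁻¹) (ℚ.*-identityˡ (ι G)) (sym (ι-* (suc a) G)) ⟩
      ι G * ι (suc a ℕ.* G) ⁻¹
        ≡⟨ cong (λ x → ι G * ι x ⁻¹) (rowH-[] a) ⟨
      rowRatio a [] ∎
      where
      open ≡-Reasoning
      G = rowH a []
      a+1≡1+a : ι a + 1ℚ - 0ℚ ≡ ι (suc a)
      a+1≡1+a = trans (solve 1 (λ x → x :+ con 1ℚ :- con 0ℚ := con 1ℚ :+ x) refl (ι a)) (sym (ι-suc a))

  module _ {b ν} (pbν : IsPartition (b ∷ ν)) (momentsν : Moments ν) where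

    private
      B = ι b
      Q = rowRatio b ν
      v : ℚ → ℚ
      v c = (B + 1ℚ - c) ⁻¹
      ν≤b : row ν 0 ≤ b
      ν≤b = row≤ (IsPartition-rows≤head pbν) 0
      cornersν = outerCorners-correct (IsPartition-tail pbν)
      gaps : All (λ κ → B + 1ℚ - content κ ≢ 0ℚ) (outerCorners ν)
      gaps = All.map (λ isCorner → IsCorner-gap isCorner b ν≤b) cornersν
      open Moments momentsν using () renaming (cauchy to cauchyν)

    𝔼-∷-reweighted : ∀ (g : ℚ → ℚ) α β γ δ →
                     All (λ κ → (1ℚ - v (content κ)) * g (content κ - 1ℚ)
                                  ≡ α * (content κ * content κ) + β * content κ + γ + δ * v (content κ)) (outerCorners ν) →
                     𝔼 (b ∷ ν) g ≡ Q * g B + (α * ι (size ν) + γ + δ * Q)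
    𝔼-∷-reweighted g α β γ δ pointwise = begin
      𝔼 (b ∷ ν) g
        ≡⟨ 𝔼-∷ pbν g ⟩
      Q * g B + 𝔼 ν (λ c → (1ℚ - v c) * g (c - 1ℚ))
        ≡⟨ cong (Q * g B +_) (𝔼-cong-local ν pointwise) ⟩
      Q * g B + 𝔼 ν (λ c → α * (c * c) + β * c + γ + δ * v c)
        ≡⟨ cong (Q * g B +_) (𝔼-combination momentsν α β γ δ v) ⟩
      Q * g B + (α * ι (size ν) + γ + δ * 𝔼 ν v)
        ≡⟨ cong (λ x → Q * g B + (α * ι (size ν) + γ + δ * x)) (cauchyν b ν≤b) ⟩
      Q * g B + (α * ι (size ν) + γ + δ * Q) ∎
      where open ≡-Reasoning

    mass-∷ : 𝔼 (b ∷ ν) (λ _ → 1ℚ) ≡ 1ℚ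
    mass-∷ = trans (𝔼-∷-reweighted (λ _ → 1ℚ) 0ℚ 0ℚ 1ℚ (- 1ℚ) (All.tabulate (λ {κ} _ → reweight-const B (content κ))))
                   (solve 2 (λ q n → q :* con 1ℚ :+ (con 0ℚ :* n :+ con 1ℚ :+ (:- con 1ℚ) :* q) := con 1ℚ) refl Q (ι (size ν)))

    mean-∷ : 𝔼 (b ∷ ν) (λ c → c) ≡ 0ℚ
    mean-∷ = trans (𝔼-∷-reweighted (λ c → c) 0ℚ 1ℚ 0ℚ (- B) (All.map (λ {κ} → reweight-linear B (content κ)) gaps))
                   (solve 3 (λ q n x → q :* x :+ (con 0ℚ :* n :+ con 0ℚ :+ (:- x) :* q) := con 0ℚ) refl Q (ι (size ν)) B)

    secondMoment-∷ : 𝔼 (b ∷ ν) (λ c → c * c) ≡ ι (size (b ∷ ν))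
    secondMoment-∷ = begin
      𝔼 (b ∷ ν) (λ c → c * c)
        ≡⟨ 𝔼-∷-reweighted (λ c → c * c) 1ℚ (- 1ℚ) B (- (B * B))
           (All.map (λ {κ} → reweight-square B (content κ)) gaps) ⟩
      Q * (B * B) + (1ℚ * ι (size ν) + B + (- (B * B)) * Q)
        ≡⟨ solve 3 (λ q n x → q :* (x :* x) :+ (con 1ℚ :* n :+ x :+ (:- (x :* x)) :* q) := x :+ n) refl Q (ι (size ν)) B ⟩
      B + ι (size ν)
        ≡⟨ ι-+ b (size ν) ⟨
      ι (size (b ∷ ν)) ∎
      where open ≡-Reasoning

    cauchy-∷ : ∀ a → b ≤ a → 𝔼 (b ∷ ν) (λ c → (ι a + 1ℚ - c) ⁻¹) ≡ rowRatio a (b ∷ ν)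
    cauchy-∷ a b≤a = begin
      𝔼 (b ∷ ν) (λ c → (ι a + 1ℚ - c) ⁻¹)
        ≡⟨ 𝔼-∷ pbν _ ⟩
      Q * k + 𝔼 ν (λ c → (1ℚ - v c) * vA c)
        ≡⟨ cong (Q * k +_) (𝔼-cong-local ν (All.zipWith
           (λ {κ} (gapB , gapA) → reweight-cauchy B (content κ) gapB (ι a) gapA a+1-b≢0) (gaps , gapsA))) ⟩
      Q * k + 𝔼 ν (λ c → (1ℚ + k) * vA c + (- k) * v c)
        ≡⟨ cong (Q * k +_) (trans (𝔼-+ ν _ _) (cong₂ _+_ (𝔼-*ˡ ν (1ℚ + k) vA) (𝔼-*ˡ ν (- k) v))) ⟩
      Q * k + ((1ℚ + k) * 𝔼 ν vA + (- k) * 𝔼 ν v)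
        ≡⟨ cong₂ (λ x y → Q * k + ((1ℚ + k) * x + (- k) * y))
           (trans (𝔼-cong ν (λ c → cong _⁻¹ (shift c))) (cauchyν (suc a) ν≤1+a)) (cauchyν b ν≤b) ⟩
      Q * k + ((1ℚ + k) * rowRatio (suc a) ν + (- k) * Q)
        ≡⟨ solve 3 (λ q k r → q :* k :+ ((con 1ℚ :+ k) :* r :+ (:- k) :* q) := (con 1ℚ :+ k) :* r)
           refl Q k (rowRatio (suc a) ν) ⟩
      (1ℚ + k) * rowRatio (suc a) ν
        ≡⟨ rowRatio-∷ b≤a pbν ⟩
      rowRatio a (b ∷ ν) ∎
      where
      open ≡-Reasoning
      k = (ι a + 1ℚ - B) ⁻¹
      vA : ℚ → ℚ
      vA c = (ι a + 1ℚ - (c - 1ℚ)) ⁻¹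
      ν≤1+a = ℕ.≤-trans ν≤b (ℕ.≤-trans b≤a (ℕ.n≤1+n a))
      shift : ∀ c → ι a + 1ℚ - (c - 1ℚ) ≡ ι (suc a) + 1ℚ - c
      shift c = trans (solve 2 (λ x c → x :+ con 1ℚ :- (c :- con 1ℚ) := (con 1ℚ :+ x) :+ con 1ℚ :- c) refl (ι a) c)
                      (cong (λ x → x + 1ℚ - c) (sym (ι-suc a)))
      gapsA : All (λ κ → ι a + 1ℚ - (content κ - 1ℚ) ≢ 0ℚ) (outerCorners ν)
      gapsA = All.map (λ {κ} isCorner gap≡0 → IsCorner-gap isCorner (suc a) ν≤1+a (trans (sym (shift (content κ))) gap≡0)) cornersν
      a+1-b≢0 : ι a + 1ℚ - B ≢ 0ℚ
      a+1-b≢0 = corner-gap a B (a ∸ b) (ι-split b≤a)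

  moments-∷ : ∀ {b ν} → IsPartition (b ∷ ν) → Moments ν → Moments (b ∷ ν)
  moments-∷ pbν momentsν = record
    { mass         = mass-∷ pbν momentsν
    ; mean         = mean-∷ pbν momentsν
    ; secondMoment = secondMoment-∷ pbν momentsν
    ; cauchy       = cauchy-∷ pbν momentsν
    }

  moments : ∀ {μ} → IsPartition μ → Moments μ
  moments {[]}    _   = moments-[]
  moments {b ∷ ν} pbν = moments-∷ pbν (moments (IsPartition-tail pbν))

  𝔼-square+const : ∀ {μ} → Moments μ → ∀ K → 𝔼 μ (λ c → c * c + K) ≡ ι (size μ) + K
  𝔼-square+const {μ} moments K =
    trans (𝔼-+ μ (λ c → c * c) (λ _ → K)) (cong₂ _+_ (Moments.secondMoment moments) (𝔼-const moments K))

module ChainSums where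

  open import Data.Nat as ℕ using (ℕ; zero; suc; _∸_; _≤_; _<_; _≤ᵇ_; z≤n; s≤s)
  import Data.Nat.Properties as ℕ
  open import Data.Nat.ListAction using (sum)
  open import Data.Bool using (true; false; T; _∧_; if_then_else_)
  open import Data.Bool.Properties using (T-∧)
  open import Data.Integer as ℤ using ()
  open import Data.Rational using (ℚ; 0ℚ; 1ℚ; _+_; _-_; _*_; _/_)
  import Data.Rational.Properties as ℚ
  open import Data.Rational.Solver using (module +-*-Solver)
  open import Data.List using (List; []; _∷_; map; upTo; applyUpTo)
  open import Data.List.Properties using (≡-dec; map-∘; map-cong; map-cong-local; map-applyUpTo; ∷-injectiveˡ; ∷-injectiveʳ)
  open import Data.List.Relation.Unary.All as All using (All; []; _∷_)
  import Data.List.Relation.Unary.All.Properties as All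
  open import Data.Product using (_,_)
  open import Data.Unit using (tt)
  open import Function using (_∘_)
  open import Function.Bundles using (Equivalence)
  open import Relation.Binary.PropositionalEquality
  open import Relation.Nullary using (Dec; yes; no; ¬_)
  open import Relation.Nullary.Negation using (contradiction)
  open import Defs
  open RationalFacts
  open Hooks
  open OuterCorners
  open HookStatistics
  open TransitionMeasure

  open +-*-Solver

  chains0-refl : ∀ μ → chains 0 μ μ ≡ 1
  chains0-refl μ with ≡-dec ℕ._≟_ μ μ
  ... | yes _   = refl
  ... | no μ≢μ = contradiction refl μ≢μ

  chains0-≢ : ∀ {μ λ′} → μ ≢ λ′ → chains 0 μ λ′ ≡ 0
  chains0-≢ {μ} {λ′} μ≢λ with ≡-dec ℕ._≟_ μ λ′
  ... | yes μ≡λ = contradiction μ≡λ μ≢λ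
  ... | no _    = refl

  chains0-∷ : ∀ a l λ′ → chains 0 (a ∷ l) (a ∷ λ′) ≡ chains 0 l λ′
  chains0-∷ a l λ′ = byCases (≡-dec ℕ._≟_ l λ′)
    where
    byCases : Dec (l ≡ λ′) → chains 0 (a ∷ l) (a ∷ λ′) ≡ chains 0 l λ′
    byCases (yes l≡λ) = subst (λ t → chains 0 (a ∷ l) (a ∷ t) ≡ chains 0 l t) l≡λ
                              (trans (chains0-refl (a ∷ l)) (sym (chains0-refl l)))
    byCases (no l≢λ)  = trans (chains0-≢ (l≢λ ∘ ∷-injectiveʳ)) (sym (chains0-≢ l≢λ))

  All-if : ∀ {A : Set} {P : A → Set} b {xs} → All P xs → All P (if b then xs else [])
  All-if true  pxs = pxs
  All-if false _   = []

  if-T : ∀ {A : Set} {b} (xs : List A) → T b → (if b then xs else []) ≡ xs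
  if-T {b = true} xs _ = refl

  partsBounded-size : ∀ f n m → All (λ λ′ → size λ′ ≡ n) (partsBounded f n m)
  partsBounded-size f       zero    m = refl ∷ []
  partsBounded-size zero    (suc n) m = []
  partsBounded-size (suc f) (suc n) m = All.concat⁺ (All.map⁺ (All.applyUpTo⁺₁ (λ k → k) (suc n) (λ {k} k<1+n →
    All-if _ (All.map⁺ (All.map (λ {t} |t|≡n-k → cong suc (trans (cong (k ℕ.+_) |t|≡n-k) (ℕ.m+[n∸m]≡n (ℕ.≤-pred k<1+n))))
                                (partsBounded-size f (n ∸ k) (suc k)))))))

  -- partsBounded f n m lists every partition of n with first row at most m exactly once (given f ≥ n).
  sumδ-partsBounded : ∀ f n m {μ} (φ : List ℕ → ℚ) → IsPartition μ → size μ ≡ n → row μ 0 ≤ m → n ≤ f →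
                      sumℚ (map (λ λ′ → ι (chains 0 μ λ′) * φ λ′) (partsBounded f n m)) ≡ φ μ
  sumδ-partsBounded f zero m {[]} φ _ _ _ _ = solve 1 (λ x → con 1ℚ :* x :+ con 0ℚ := x) refl (φ [])
  sumδ-partsBounded f zero m {a ∷ l} φ pμ |μ|≡0 _ _ =
    contradiction |μ|≡0 (ℕ.>⇒≢ (ℕ.<-≤-trans (IsPartition-head>0 pμ) (ℕ.m≤m+n a (size l))))
  sumδ-partsBounded f (suc n) m {[]} φ _ () _ _
  sumδ-partsBounded zero (suc n) m {_ ∷ _} φ _ _ _ ()
  sumδ-partsBounded (suc f) (suc n) m {zero ∷ l} φ pμ _ _ _ = contradiction (IsPartition-head>0 pμ) λ ()
  sumδ-partsBounded (suc f) (suc n) m {suc k ∷ l} φ pμ |μ|≡1+n k<m (s≤s n≤f) = begin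
    sumℚ (map δφ (Data.List.concatMap block (upTo (suc n))))
      ≡⟨ sumℚ-concatMap δφ block (upTo (suc n)) ⟩
    sumℚ (map (λ i → sumℚ (map δφ (block i))) (upTo (suc n)))
      ≡⟨ cong sumℚ (map-applyUpTo (λ i → i) (λ i → sumℚ (map δφ (block i))) (suc n)) ⟩
    sumℚ (applyUpTo (λ i → sumℚ (map δφ (block i))) (suc n))
      ≡⟨ sumℚ-applyUpTo-single _ (s≤s k≤n) otherBlocks ⟩
    sumℚ (map δφ (block k))
      ≡⟨ cong (sumℚ ∘ map δφ) (if-T _ (Equivalence.from T-∧ (ℕ.≤⇒≤ᵇ k<m , ℕ.≤⇒≤ᵇ (s≤s k≤n)))) ⟩
    sumℚ (map δφ (map (suc k ∷_) tails))
      ≡⟨ cong sumℚ (sym (map-∘ tails)) ⟩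
    sumℚ (map (δφ ∘ (suc k ∷_)) tails)
      ≡⟨ cong sumℚ (map-cong (λ t → cong (λ x → ι x * φ (suc k ∷ t)) (chains0-∷ (suc k) l t)) tails) ⟩
    sumℚ (map (λ t → ι (chains 0 l t) * φ (suc k ∷ t)) tails)
      ≡⟨ sumδ-partsBounded f (n ∸ k) (suc k) (φ ∘ (suc k ∷_)) (IsPartition-tail pμ) |l|≡n-k
         (row≤ (IsPartition-rows≤head pμ) 0) (ℕ.≤-trans (ℕ.m∸n≤m n k) n≤f) ⟩
    φ (suc k ∷ l) ∎
    where
    open ≡-Reasoning
    tails = partsBounded f (n ∸ k) (suc k)
    δφ : List ℕ → ℚ
    δφ λ′ = ι (chains 0 (suc k ∷ l) λ′) * φ λ′
    block : ℕ → List (List ℕ)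
    block i = if (suc i ≤ᵇ m) ∧ (suc i ≤ᵇ suc n) then map (suc i ∷_) (partsBounded f (suc n ∸ suc i) (suc i)) else []
    k+|l|≡n = ℕ.suc-injective |μ|≡1+n
    k≤n : k ≤ n
    k≤n = subst (k ≤_) k+|l|≡n (ℕ.m≤m+n k (size l))
    |l|≡n-k : size l ≡ n ∸ k
    |l|≡n-k = trans (sym (ℕ.m+n∸m≡n k (size l))) (cong (_∸ k) k+|l|≡n)
    δφ-otherHead : ∀ {i} → i ≢ k → ∀ t → δφ (suc i ∷ t) ≡ 0ℚ
    δφ-otherHead {i} i≢k t =
      trans (cong (λ x → ι x * φ (suc i ∷ t)) (chains0-≢ {suc k ∷ l} {suc i ∷ t} (i≢k ∘ sym ∘ ℕ.suc-injective ∘ ∷-injectiveˡ)))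
            (ℚ.*-zeroˡ (φ (suc i ∷ t)))
    otherBlocks : ∀ {i} → i < suc n → i ≢ k → sumℚ (map δφ (block i)) ≡ 0ℚ
    otherBlocks {i} _ i≢k = sumℚ-zero (All.map⁺ (All-if ((suc i ≤ᵇ m) ∧ (suc i ≤ᵇ suc n))
      (All.map⁺ (All.tabulate {xs = partsBounded f (suc n ∸ suc i) (suc i)} (λ {t} _ → δφ-otherHead i≢k t)))))

  ⊆ᵇ-refl : ∀ l → T (l ⊆ᵇ l)
  ⊆ᵇ-refl []      = tt
  ⊆ᵇ-refl (a ∷ l) = Equivalence.from T-∧ (ℕ.≤⇒≤ᵇ (ℕ.≤-refl {a}) , ⊆ᵇ-refl l)

  ⊆ᵇ-trans : ∀ k l m → T (k ⊆ᵇ l) → T (l ⊆ᵇ m) → T (k ⊆ᵇ m)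
  ⊆ᵇ-trans []      _       _       _   _   = tt
  ⊆ᵇ-trans (_ ∷ _) []      _       ()  _
  ⊆ᵇ-trans (_ ∷ _) (_ ∷ _) []      _   ()
  ⊆ᵇ-trans (a ∷ k) (b ∷ l) (c ∷ m) a∷k⊆b∷l b∷l⊆c∷m with Equivalence.to (T-∧ {a ≤ᵇ b} {k ⊆ᵇ l}) a∷k⊆b∷l
                                                     | Equivalence.to (T-∧ {b ≤ᵇ c} {l ⊆ᵇ m}) b∷l⊆c∷m
  ... | a≤b , k⊆l | b≤c , l⊆m =
    Equivalence.from T-∧ (ℕ.≤⇒≤ᵇ (ℕ.≤-trans (ℕ.≤ᵇ⇒≤ a b a≤b) (ℕ.≤ᵇ⇒≤ b c b≤c)) , ⊆ᵇ-trans k l m k⊆l l⊆m)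

  outerCorners-⊇ : ∀ μ → All (λ κ → T (μ ⊆ᵇ diagram κ)) (outerCorners μ)
  outerCorners-⊇ []      = tt ∷ []
  outerCorners-⊇ (a ∷ l) = Equivalence.from T-∧ (ℕ.≤⇒≤ᵇ (ℕ.n≤1+n a) , ⊆ᵇ-refl l)
    ∷ All.map⁺ (All.map (λ l⊆λ → Equivalence.from T-∧ (ℕ.≤⇒≤ᵇ (ℕ.≤-refl {a}) , l⊆λ))
                        (All-outerCornersUnder a l (outerCorners-⊇ l)))

  addBox-⊇ : ∀ μ → All (λ ν → T (μ ⊆ᵇ ν)) (addBox μ)
  addBox-⊇ μ = subst (All (λ ν → T (μ ⊆ᵇ ν))) (map-diagram-outerCorners μ) (All.map⁺ (outerCorners-⊇ μ))

  addBox-size : ∀ {μ} → IsPartition μ → All (λ ν → size ν ≡ suc (size μ)) (addBox μ)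
  addBox-size {μ} pμ = subst (All (λ ν → size ν ≡ suc (size μ))) (map-diagram-outerCorners μ)
                             (All.map⁺ (All.map IsCorner.size≡ (outerCorners-correct pμ)))

  chains-⊈ : ∀ k {μ λ′} → ¬ T (μ ⊆ᵇ λ′) → chains k μ λ′ ≡ 0
  chains-⊈ zero    {μ} μ⊈λ = chains0-≢ (λ μ≡λ → μ⊈λ (subst (λ ν → T (μ ⊆ᵇ ν)) μ≡λ (⊆ᵇ-refl μ)))
  chains-⊈ (suc k) {μ} {λ′} μ⊈λ =
    sum-zero (All.map⁺ (All.map (λ {ν} μ⊆ν → chains-⊈ k (λ ν⊆λ → μ⊈λ (⊆ᵇ-trans μ ν λ′ μ⊆ν ν⊆λ))) (addBox-⊇ μ)))
    where
    sum-zero : ∀ {ns} → All (_≡ 0) ns → sum ns ≡ 0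
    sum-zero []             = refl
    sum-zero (refl ∷ ns≡0) = sum-zero ns≡0

  chainSum : ℕ → List ℕ → (List ℕ → ℚ) → ℚ
  chainSum k μ φ = sumℚ (map (λ λ′ → ι (chains k μ λ′) * φ λ′) (partitions (size μ ℕ.+ k)))

  chainSum-zero : ∀ {μ} φ → IsPartition μ → chainSum 0 μ φ ≡ φ μ
  chainSum-zero {μ} φ pμ =
    trans (cong (λ n → sumℚ (map (λ λ′ → ι (chains 0 μ λ′) * φ λ′) (partitions n))) (ℕ.+-identityʳ (size μ)))
          (sumδ-partsBounded (size μ) (size μ) (size μ) φ pμ refl (row0≤size μ) ℕ.≤-refl)
    where
    row0≤size : ∀ μ → row μ 0 ≤ size μ
    row0≤size []      = z≤n
    row0≤size (a ∷ l) = ℕ.m≤m+n a (size l)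

  chainSum-suc : ∀ k {μ} φ → IsPartition μ → chainSum (suc k) μ φ ≡ sumℚ (map (λ ν → chainSum k ν φ) (addBox μ))
  chainSum-suc k {μ} φ pμ = begin
    sumℚ (map (λ λ′ → ι (sum (map (λ ν → chains k ν λ′) (addBox μ))) * φ λ′) partitions⁺)
      ≡⟨ cong sumℚ (map-cong (λ λ′ → ι-sum-* (λ ν → chains k ν λ′) (addBox μ) (φ λ′)) partitions⁺) ⟩
    sumℚ (map (λ λ′ → sumℚ (map (λ ν → ι (chains k ν λ′) * φ λ′) (addBox μ))) partitions⁺)
      ≡⟨ sumℚ-swap (λ λ′ ν → ι (chains k ν λ′) * φ λ′) partitions⁺ (addBox μ) ⟩
    sumℚ (map (λ ν → sumℚ (map (λ λ′ → ι (chains k ν λ′) * φ λ′) partitions⁺)) (addBox μ))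
      ≡⟨ cong sumℚ (map-cong-local (All.map (λ {ν} |ν|≡1+|μ| → cong (sumAt ν) (trans (ℕ.+-suc (size μ) k)
                                                                                 (cong (ℕ._+ k) (sym |ν|≡1+|μ|))))
                                             (addBox-size pμ))) ⟩
    sumℚ (map (λ ν → chainSum k ν φ) (addBox μ)) ∎
    where
    open ≡-Reasoning
    partitions⁺ = partitions (size μ ℕ.+ suc k)
    sumAt : List ℕ → ℕ → ℚ
    sumAt ν n = sumℚ (map (λ λ′ → ι (chains k ν λ′) * φ λ′) (partitions n))
    ι-sum-* : ∀ {A : Set} (g : A → ℕ) xs q → ι (sum (map g xs)) * q ≡ sumℚ (map (λ x → ι (g x) * q) xs)
    ι-sum-* g xs q = trans (cong (_* q) (trans (ι-sum (map g xs)) (cong sumℚ (sym (map-∘ xs)))))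
                           (sym (sumℚ-map-*ʳ (ι ∘ g) q xs))

  φ : ℚ → List ℕ → ℚ
  φ s λ′ = ι (H λ′) ⁻¹ * (ι (S1 λ′) - s)

  ΔS : ℕ → ℕ → ℚ
  ΔS k m = (ℤ.+ 3 / 2) * ι k * (ι (m ℕ.+ k) + ι m - 1ℚ)

  ΔS-suc : ∀ k m → ι m + ι 2 * ι m + ΔS k (suc m) ≡ ΔS (suc k) m
  ΔS-suc k m = begin
    ι m + ι 2 * ι m + (ℤ.+ 3 / 2) * ι k * (ι (suc m ℕ.+ k) + ι (suc m) - 1ℚ)
      ≡⟨ cong₂ (λ x y → ι m + ι 2 * ι m + (ℤ.+ 3 / 2) * ι k * (x + y - 1ℚ))
         (trans (ι-suc (m ℕ.+ k)) (cong (1ℚ +_) (ι-+ m k))) (ι-suc m) ⟩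
    ι m + ι 2 * ι m + (ℤ.+ 3 / 2) * ι k * ((1ℚ + (ι m + ι k)) + (1ℚ + ι m) - 1ℚ)
      ≡⟨ solve 2 (λ x y → x :+ con (ι 2) :* x :+ con (ℤ.+ 3 / 2) :* y :* ((con 1ℚ :+ (x :+ y)) :+ (con 1ℚ :+ x) :- con 1ℚ)
                        := con (ℤ.+ 3 / 2) :* (con 1ℚ :+ y) :* ((x :+ (con 1ℚ :+ y)) :+ x :- con 1ℚ))
                 refl (ι m) (ι k) ⟩
    (ℤ.+ 3 / 2) * (1ℚ + ι k) * ((ι m + (1ℚ + ι k)) + ι m - 1ℚ)
      ≡⟨ cong₂ (λ x y → (ℤ.+ 3 / 2) * x * (y + ι m - 1ℚ))
               (sym (ι-suc k)) (trans (cong (ι m +_) (sym (ι-suc k))) (sym (ι-+ m (suc k)))) ⟩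
    ΔS (suc k) m ∎
    where open ≡-Reasoning

  ι-H⁻¹-weight : ∀ {μ} → IsPartition μ → ∀ λ′ → ι (H λ′) ⁻¹ ≡ ι (H μ) ⁻¹ * weight μ λ′
  ι-H⁻¹-weight {μ} pμ λ′ = sym (begin
    ι (H μ) ⁻¹ * (ι (H μ) * ι (H λ′) ⁻¹)    ≡⟨ ℚ.*-assoc (ι (H μ) ⁻¹) (ι (H μ)) (ι (H λ′) ⁻¹) ⟨
    (ι (H μ) ⁻¹ * ι (H μ)) * ι (H λ′) ⁻¹    ≡⟨ cong (_* ι (H λ′) ⁻¹) (⁻¹-inverseˡ (ι-H≢0 pμ)) ⟩
    1ℚ * ι (H λ′) ⁻¹                        ≡⟨ ℚ.*-identityˡ (ι (H λ′) ⁻¹) ⟩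
    ι (H λ′) ⁻¹                             ∎)
    where open ≡-Reasoning

  chainSum-φ : ∀ k {μ} s → IsPartition μ → chainSum k μ (φ s) ≡ ι (H μ) ⁻¹ * ((ι (S1 μ) - s) + ΔS k (size μ))
  chainSum-φ zero {μ} s pμ = begin
    chainSum 0 μ (φ s)
      ≡⟨ chainSum-zero (φ s) pμ ⟩
    ι (H μ) ⁻¹ * (ι (S1 μ) - s)
      ≡⟨ solve 4 (λ h d c x → h :* d := h :* (d :+ c :* con 0ℚ :* x)) refl
         (ι (H μ) ⁻¹) (ι (S1 μ) - s) (ℤ.+ 3 / 2) (ι (size μ ℕ.+ 0) + ι (size μ) - 1ℚ) ⟩
    ι (H μ) ⁻¹ * ((ι (S1 μ) - s) + ΔS 0 (size μ)) ∎
    where open ≡-Reasoning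
  chainSum-φ (suc k) {μ} s pμ = begin
    chainSum (suc k) μ (φ s)
      ≡⟨ chainSum-suc k (φ s) pμ ⟩
    sumℚ (map (λ ν → chainSum k ν (φ s)) (addBox μ))
      ≡⟨ cong (sumℚ ∘ map (λ ν → chainSum k ν (φ s))) (map-diagram-outerCorners μ) ⟨
    sumℚ (map (λ ν → chainSum k ν (φ s)) (map diagram (outerCorners μ)))
      ≡⟨ cong sumℚ (sym (map-∘ (outerCorners μ))) ⟩
    sumℚ (map (λ κ → chainSum k (diagram κ) (φ s)) (outerCorners μ))
      ≡⟨ cong sumℚ (map-cong-local (All.zipWith (uncurry perCorner) (outerCorners-correct pμ , S1-increments pμ))) ⟩
    sumℚ (map (λ κ → h⁻¹ * (weight μ (diagram κ) * (content κ * content κ + K))) (outerCorners μ))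
      ≡⟨ sumℚ-map-*ˡ h⁻¹ _ (outerCorners μ) ⟩
    h⁻¹ * 𝔼 μ (λ c → c * c + K)
      ≡⟨ cong (h⁻¹ *_) (𝔼-square+const (moments pμ) K) ⟩
    h⁻¹ * (ι m + K)
      ≡⟨ solve 6 (λ h m S s t g → h :* (m :+ ((S :+ t :* m :- s) :+ g)) := h :* ((S :- s) :+ (m :+ t :* m :+ g)))
         refl h⁻¹ (ι m) (ι (S1 μ)) s (ι 2) (ΔS k (suc m)) ⟩
    h⁻¹ * ((ι (S1 μ) - s) + (ι m + ι 2 * ι m + ΔS k (suc m)))
      ≡⟨ cong (λ x → h⁻¹ * ((ι (S1 μ) - s) + x)) (ΔS-suc k m) ⟩
    h⁻¹ * ((ι (S1 μ) - s) + ΔS (suc k) m) ∎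
    where
    open ≡-Reasoning
    open Data.Product using (uncurry)
    m = size μ
    h⁻¹ = ι (H μ) ⁻¹
    K = (ι (S1 μ) + ι 2 * ι m - s) + ΔS k (suc m)
    perCorner : ∀ {κ} → IsCorner μ κ → S1-increment μ κ →
                chainSum k (diagram κ) (φ s) ≡ h⁻¹ * (weight μ (diagram κ) * (content κ * content κ + K))
    perCorner {κ} isCorner S1-inc = begin
      chainSum k λ′ (φ s)
        ≡⟨ chainSum-φ k s (IsCorner.isPartition isCorner) ⟩
      ι (H λ′) ⁻¹ * ((ι (S1 λ′) - s) + ΔS k (size λ′))
        ≡⟨ cong₂ (λ x y → x * ((y - s) + ΔS k (size λ′))) (ι-H⁻¹-weight pμ λ′) S1-inc ⟩
      (h⁻¹ * w) * ((ι (S1 μ) + (c * c + ι 2 * ι m) - s) + ΔS k (size λ′))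
        ≡⟨ cong (λ n → (h⁻¹ * w) * ((ι (S1 μ) + (c * c + ι 2 * ι m) - s) + ΔS k n)) (IsCorner.size≡ isCorner) ⟩
      (h⁻¹ * w) * ((ι (S1 μ) + (c * c + ι 2 * ι m) - s) + ΔS k (suc m))
        ≡⟨ solve 8 (λ h w S c t n s g → (h :* w) :* ((S :+ (c :* c :+ t :* n) :- s) :+ g) := h :* (w :* (c :* c :+ ((S :+ t :* n :- s) :+ g))))
           refl h⁻¹ w (ι (S1 μ)) c (ι 2) (ι m) s (ΔS k (suc m)) ⟩
      h⁻¹ * (w * (c * c + K)) ∎
      where
      λ′ = diagram κ
      c = content κ
      w = weight μ λ′

open import Defs
open import Data.Nat using (ℕ; _≤_)
import Data.Nat
open import Data.List using (List; map)
open import Data.Integer using (+_; -_)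
open import Data.Rational using (ℚ; _+_; _-_; _*_; _/_; ½)
open import Relation.Binary.PropositionalEquality using (_≡_)

open import Data.Nat as ℕ using (_∸_)
import Data.Nat.Properties as ℕ
open import Data.Bool using (T)
open import Data.List.Properties using (map-cong-local)
open import Data.List.Relation.Unary.All as All using (All)
open import Data.Rational using (0ℚ; 1ℚ)
import Data.Rational.Properties as ℚ
open import Data.Rational.Solver using (module +-*-Solver)
open import Relation.Binary.PropositionalEquality using (refl; sym; trans; cong; module ≡-Reasoning)
open import Relation.Nullary using (¬_)
open RationalFacts
open Hooks
open HookStatistics using (ι-H≢0)
open ChainSums

module _ (μ : List ℕ) where

  summand : List ℕ → ℚ
  summand λ′ = frac (H μ Data.Nat.* f λ′ μ) (H λ′) * ((+ S1 λ′ / 1) - (+ S1 μ / 1))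

  summand-⊈ : ∀ λ′ → ¬ T (μ ⊆ᵇ λ′) → summand λ′ ≡ 0ℚ
  summand-⊈ λ′ μ⊈λ = begin
    frac (H μ ℕ.* f λ′ μ) (H λ′) * (ι (S1 λ′) - ι (S1 μ))
      ≡⟨ cong (λ c → frac (H μ ℕ.* c) (H λ′) * (ι (S1 λ′) - ι (S1 μ)))
         (chains-⊈ (size λ′ ∸ size μ) μ⊈λ) ⟩
    frac (H μ ℕ.* 0) (H λ′) * (ι (S1 λ′) - ι (S1 μ))
      ≡⟨ cong (λ x → frac x (H λ′) * (ι (S1 λ′) - ι (S1 μ))) (ℕ.*-zeroʳ (H μ)) ⟩
    frac 0 (H λ′) * (ι (S1 λ′) - ι (S1 μ))
      ≡⟨ cong (_* (ι (S1 λ′) - ι (S1 μ))) (trans (frac≡*⁻¹ 0 (H λ′)) (ℚ.*-zeroˡ (ι (H λ′) ⁻¹))) ⟩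
    0ℚ * (ι (S1 λ′) - ι (S1 μ))
      ≡⟨ ℚ.*-zeroˡ (ι (S1 λ′) - ι (S1 μ)) ⟩
    0ℚ ∎
    where open ≡-Reasoning

  summand≡ : ∀ {n λ′} → size λ′ ≡ n → summand λ′ ≡ ι (H μ) * (ι (chains (n ∸ size μ) μ λ′) * φ (ι (S1 μ)) λ′)
  summand≡ {n} {λ′} refl = begin
    frac (H μ ℕ.* f λ′ μ) (H λ′) * (ι (S1 λ′) - ι (S1 μ))
      ≡⟨ cong (_* (ι (S1 λ′) - ι (S1 μ)))
         (trans (frac≡*⁻¹ (H μ ℕ.* f λ′ μ) (H λ′)) (cong (_* ι (H λ′) ⁻¹) (ι-* (H μ) (f λ′ μ)))) ⟩
    ((ι (H μ) * ι (f λ′ μ)) * ι (H λ′) ⁻¹) * (ι (S1 λ′) - ι (S1 μ))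
      ≡⟨ solve 4 (λ a b i d → ((a :* b) :* i) :* d := a :* (b :* (i :* d)))
               refl (ι (H μ)) (ι (f λ′ μ)) (ι (H λ′) ⁻¹) (ι (S1 λ′) - ι (S1 μ)) ⟩
    ι (H μ) * (ι (f λ′ μ) * φ (ι (S1 μ)) λ′) ∎
    where
    open ≡-Reasoning
    open +-*-Solver

theorem1p8 : (μ : List ℕ) → IsPartition μ → (n : ℕ) → size μ ≤ n →
    sumℚ (map (λ λ' → frac (H μ Data.Nat.* f λ' μ) (H λ') * ((+ S1 λ' / 1) - (+ S1 μ / 1)))
              (partitionsContaining μ n))
      ≡ (+ 3 / 2) * (+ (n Data.Nat.∸ size μ) / 1) * ((+ (n Data.Nat.+ size μ) / 1) - (+ 1 / 1))
theorem1p8 μ pμ n m≤n = begin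
  sumℚ (map (summand μ) (partitionsContaining μ n))
    ≡⟨ sumℚ-filterᵇ (μ ⊆ᵇ_) (summand μ) (partitions n) (summand-⊈ μ) ⟩
  sumℚ (map (summand μ) (partitions n))
    ≡⟨ cong sumℚ (map-cong-local (All.map (summand≡ μ) (partsBounded-size n n n))) ⟩
  sumℚ (map (λ λ′ → ι (H μ) * (ι (chains k μ λ′) * φ s λ′)) (partitions n))
    ≡⟨ sumℚ-map-*ˡ (ι (H μ)) (λ λ′ → ι (chains k μ λ′) * φ s λ′) (partitions n) ⟩
  ι (H μ) * sumℚ (map (λ λ′ → ι (chains k μ λ′) * φ s λ′) (partitions n))
    ≡⟨ cong (λ n → ι (H μ) * sumℚ (map (λ λ′ → ι (chains k μ λ′) * φ s λ′) (partitions n))) m+k≡n ⟨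
  ι (H μ) * chainSum k μ (φ s)
    ≡⟨ cong (ι (H μ) *_) (chainSum-φ k s pμ) ⟩
  ι (H μ) * (ι (H μ) ⁻¹ * ((s - s) + ΔS k m))
    ≡⟨ solve 4 (λ h i s g → h :* (i :* ((s :- s) :+ g)) := (h :* i) :* g) refl (ι (H μ)) (ι (H μ) ⁻¹) s (ΔS k m) ⟩
  (ι (H μ) * ι (H μ) ⁻¹) * ΔS k m
    ≡⟨ trans (cong (_* ΔS k m) (⁻¹-inverseʳ (ι-H≢0 pμ))) (ℚ.*-identityˡ _) ⟩
  (+ 3 / 2) * ι k * (ι (m ℕ.+ k) + ι m - 1ℚ)
    ≡⟨ cong (λ x → (+ 3 / 2) * ι k * (x - 1ℚ)) (trans (sym (ι-+ (m ℕ.+ k) m)) (cong (λ x → ι (x ℕ.+ m)) m+k≡n)) ⟩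
  (+ 3 / 2) * ι k * (ι (n ℕ.+ m) - 1ℚ) ∎
  where
  open ≡-Reasoning
  open +-*-Solver
  m = size μ
  k = n ∸ m
  s = ι (S1 μ)
  m+k≡n = ℕ.m+[n∸m]≡n m≤n
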